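{- For every positive integer $n$, the denominator of the polynomial $E_n(x)-E_n(1)$ (i.e., the least common multiple of the denominators of its rational coefficients, each written in lowest terms) equals $2^{\nu_2(n+1)-g(n)}$, where $\nu_2(m)$ denotes the $2$-adic order of $m$, and $g(n)=1$ if $n=2^m-1$ for some integer $m\geq 1$, while $g(n)=0$ otherwise.
   Context: $E_n(x)$ denotes the Euler polynomial, defined by the generating function $\frac{2e^{xt}}{e^t+1}=\sum_{n=0}^{\infty}E_n(x)\frac{t^n}{n!}$. $\{g(n)\}_{n\ge1}$ is the characteristic sequence of the set $\{2^{m}-1\}_{m\geq1}$. -}

module Defs where

open import Data.Nat using (ℕ; zero; suc; _≟_; _^_; _∸_; _≤_)
open import Data.Nat.LCM using (lcm)
open import Data.Nat.Combinatorics using (_C_)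
open import Data.Integer using (+_)
open import Data.Rational using (ℚ; 0ℚ; 1ℚ; ½; _+_; _-_; _*_; _/_; ↧ₙ_)
open import Data.List using (List; []; _∷_; _++_; [_]; zipWith; upTo; foldr; map)
open import Data.Product using (∃-syntax; _×_)
open import Relation.Binary.PropositionalEquality using (_≡_)
open import Relation.Nullary.Decidable using (does)
open import Data.Bool using (if_then_else_)

-- A polynomial over ℚ is represented by its coefficient function:
-- p j is the coefficient of x^j.
Poly : Set
Poly = ℕ → ℚ

ℕ→ℚ : ℕ → ℚ
ℕ→ℚ n = (+ n) / 1

sumℚ : List ℚ → ℚ
sumℚ = foldr _+_ 0ℚ

-- Coefficient comparison in  2 e^{xt} = (e^t + 1) Σ E_n(x) t^n/n!  gives
--   2 E_n(x) + Σ_{k<n} C(n,k) E_k(x) = 2 x^n,  i.e.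
--   E_n(x) = x^n - ½ Σ_{k<n} C(n,k) E_k(x).
-- eulerStep n [E_0,…,E_{n-1}] = E_n.
eulerStep : ℕ → List Poly → Poly
eulerStep n prev j =
  (if does (n ≟ j) then 1ℚ else 0ℚ)
  - ½ * sumℚ (zipWith (λ k e → ℕ→ℚ (n C k) * e j) (upTo n) prev)

eulerList : ℕ → List Poly
eulerList zero = []
eulerList (suc n) = eulerList n ++ [ eulerStep n (eulerList n) ]

euler : ℕ → Poly
euler n = eulerStep n (eulerList n)

evalAt1 : ℕ → Poly → ℚ
evalAt1 d p = sumℚ (map p (upTo (suc d)))

eulerShift : ℕ → Poly
eulerShift n zero = euler n zero - evalAt1 n (euler n)
eulerShift n (suc j) = euler n (suc j)

polyDenom : ℕ → Poly → ℕ
polyDenom d p = foldr lcm 1 (map (λ j → ↧ₙ (p j)) (upTo (suc d)))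

IsMersenne : ℕ → Set
IsMersenne n = ∃[ m ] (1 ≤ m × n ≡ 2 ^ m ∸ 1)

private
  open import Data.Integer using (-[1+_])
  t1 : euler 1 0 ≡ -[1+ 0 ] / 2
  t1 = Relation.Binary.PropositionalEquality.refl
  t2 : euler 3 2 ≡ -[1+ 2 ] / 2
  t2 = Relation.Binary.PropositionalEquality.refl
  t3 : euler 3 0 ≡ (+ 1) / 4
  t3 = Relation.Binary.PropositionalEquality.refl
  t4 : polyDenom 1 (eulerShift 1) ≡ 1
  t4 = Relation.Binary.PropositionalEquality.refl
  t5 : polyDenom 3 (eulerShift 3) ≡ 2
  t5 = Relation.Binary.PropositionalEquality.refl
  t6 : polyDenom 5 (eulerShift 5) ≡ 2
  t6 = Relation.Binary.PropositionalEquality.refl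

module Submission where

-- Eₙ(x) = 2⁻ⁿ Σⱼ C(n,j) 2ʲ Aₙ₋ⱼ xʲ, where the integers Aₘ = 2ᵐ Eₘ(0) have exponential
-- generating function 2/(e²ᵗ+1) and hence satisfy the Riccati equation A′ = A² − 2A.
-- Since Eₙ(1) = −Eₙ(0) for n ≥ 1, multiplying Eₙ(x) − Eₙ(1) by n+1 turns its coefficient of
-- x^(n−i) into C(n+1,i+1)·G_(i+1) and its constant term into 2·G_(n+1), where the Genocchi
-- numbers are given by (i+1)Aᵢ = 2ⁱ G_(i+1); the Riccati equation shows 2-adically that they
-- are integers and that G_(2ʳ) is odd. Writing n+1 = 2ᵏN with N odd, every coefficient thus
-- has denominator dividing 2ᵏ. Unless n = 2ᵏ − 1, the coefficient of x^(n+1−2ᵏ) attains 2ᵏ,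
-- because C(2ᵏN, 2ᵏ) is odd (Lucas). If n = 2ᵏ − 1, every C(2ᵏ, i+1) with i < n is even, so
-- the bound drops to 2ᵏ⁻¹, which the constant term 2·G_(2ᵏ)/2ᵏ attains.

module Binomial where

  open import Data.Nat
  open import Data.Nat.Properties
  open import Data.Nat.Combinatorics using (_C_; nCk+nC[k+1]≡[n+1]C[k+1]; nCn≡1; k>n⇒nCk≡0; nCk≡nC[n∸k])
  open import Relation.Binary.PropositionalEquality
  open import Data.Nat.Tactic.RingSolver using (solve-∀)
  open ≡-Reasoning

  -- Pascal's rule holds by definition here, which is what the parity inductions need.
  binom : ℕ → ℕ → ℕ
  binom n       zero    = 1
  binom zero    (suc k) = 0
  binom (suc n) (suc k) = binom n k + binom n (suc k)

  binom≡C : ∀ n k → binom n k ≡ n C k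
  binom≡C n       zero    = sym (trans (nCk≡nC[n∸k] {0} {n} z≤n) (nCn≡1 n))
  binom≡C zero    (suc k) = sym (k>n⇒nCk≡0 {0} {suc k} (s≤s z≤n))
  binom≡C (suc n) (suc k) =
    trans (cong₂ _+_ (binom≡C n k) (binom≡C n (suc k))) (nCk+nC[k+1]≡[n+1]C[k+1] n k)

  k>n⇒binom≡0 : ∀ {n k} → n < k → binom n k ≡ 0
  k>n⇒binom≡0 {zero}  {suc k} _         = refl
  k>n⇒binom≡0 {suc n} {suc k} (s≤s n<k) =
    cong₂ _+_ (k>n⇒binom≡0 n<k) (k>n⇒binom≡0 (m<n⇒m<1+n n<k))

  binom[n,n]≡1 : ∀ n → binom n n ≡ 1
  binom[n,n]≡1 zero    = refl
  binom[n,n]≡1 (suc n) = cong₂ _+_ (binom[n,n]≡1 n) (k>n⇒binom≡0 (n<1+n n))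

  binom[n,1]≡n : ∀ n → binom n 1 ≡ n
  binom[n,1]≡n zero    = refl
  binom[n,1]≡n (suc n) = cong suc (binom[n,1]≡n n)

  binom-sym : ∀ {n k} → k ≤ n → binom n k ≡ binom n (n ∸ k)
  binom-sym {n} {k} k≤n =
    trans (binom≡C n k) (trans (nCk≡nC[n∸k] k≤n) (sym (binom≡C n (n ∸ k))))

  binom-absorption : ∀ n k → suc k * binom (suc n) (suc k) ≡ suc n * binom n k
  binom-absorption zero    zero    = refl
  binom-absorption zero    (suc k) = *-zeroʳ (suc (suc k))
  binom-absorption (suc n) zero    =
    trans (+-identityʳ _) (trans (binom[n,1]≡n (suc (suc n))) (sym (*-identityʳ (suc (suc n)))))
  binom-absorption (suc n) (suc k) = begin
    suc (suc k) * (X + Y)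
      ≡⟨ split k X Y ⟩
    X + suc k * X + suc (suc k) * Y
      ≡⟨ cong₂ (λ u v → X + u + v) (binom-absorption n k) (binom-absorption n (suc k)) ⟩
    X + suc n * binom n k + suc n * binom n (suc k)
      ≡⟨ merge X n (binom n k) (binom n (suc k)) ⟩
    X + suc n * X ∎
    where
    X = binom (suc n) (suc k)
    Y = binom (suc n) (suc (suc k))
    split : ∀ k X Y → suc (suc k) * (X + Y) ≡ X + suc k * X + suc (suc k) * Y
    split = solve-∀
    merge : ∀ X n a b → X + suc n * a + suc n * b ≡ X + suc n * (a + b)
    merge = solve-∀

  binom-subset-of-subset : ∀ n a b → binom n (a + b) * binom (a + b) a ≡ binom n a * binom (n ∸ a) b
  binom-subset-of-subset n       zero    b = trans (*-identityʳ _) (sym (+-identityʳ _))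
  binom-subset-of-subset zero    (suc a) b = refl
  binom-subset-of-subset (suc n) (suc a) b =
    *-cancelˡ-≡ (binom (suc n) (suc s) * binom (suc s) (suc a)) (binom (suc n) (suc a) * binom (n ∸ a) b) (suc a)
        (begin
    suc a * (binom (suc n) (suc s) * binom (suc s) (suc a))
      ≡⟨ exchange (suc a) (binom (suc n) (suc s)) (binom (suc s) (suc a)) ⟩
    binom (suc n) (suc s) * (suc a * binom (suc s) (suc a))
      ≡⟨ cong (binom (suc n) (suc s) *_) (binom-absorption s a) ⟩
    binom (suc n) (suc s) * (suc s * binom s a)
      ≡⟨ exchange (binom (suc n) (suc s)) (suc s) (binom s a) ⟩
    suc s * (binom (suc n) (suc s) * binom s a)
      ≡⟨ sym (*-assoc (suc s) (binom (suc n) (suc s)) (binom s a)) ⟩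
    suc s * binom (suc n) (suc s) * binom s a
      ≡⟨ cong (_* binom s a) (binom-absorption n s) ⟩
    suc n * binom n s * binom s a
      ≡⟨ *-assoc (suc n) (binom n s) (binom s a) ⟩
    suc n * (binom n s * binom s a)
      ≡⟨ cong (suc n *_) (binom-subset-of-subset n a b) ⟩
    suc n * (binom n a * binom (n ∸ a) b)
      ≡⟨ sym (*-assoc (suc n) (binom n a) (binom (n ∸ a) b)) ⟩
    suc n * binom n a * binom (n ∸ a) b
      ≡⟨ cong (_* binom (n ∸ a) b) (sym (binom-absorption n a)) ⟩
    suc a * binom (suc n) (suc a) * binom (n ∸ a) b
      ≡⟨ *-assoc (suc a) (binom (suc n) (suc a)) (binom (n ∸ a) b) ⟩
    suc a * (binom (suc n) (suc a) * binom (suc n ∸ suc a) b) ∎)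
    where
    s = a + b
    exchange : ∀ x y z → x * (y * z) ≡ y * (x * z)
    exchange = solve-∀

  binom-double-absorption : ∀ {n k} → k ≤ n →
    suc (suc n) * suc n * binom n k ≡ binom (suc (suc n)) (suc k) * suc k * suc (n ∸ k)
  binom-double-absorption {n} {k} k≤n = begin
    suc (suc n) * suc n * binom n k
      ≡⟨ *-assoc (suc (suc n)) (suc n) (binom n k) ⟩
    suc (suc n) * (suc n * binom n k)
      ≡⟨ cong (suc (suc n) *_) (sym (binom-absorption n k)) ⟩
    suc (suc n) * (suc k * binom (suc n) (suc k))
      ≡⟨ cong (λ u → suc (suc n) * (suc k * u)) (binom-sym (s≤s k≤n)) ⟩
    suc (suc n) * (suc k * binom (suc n) (n ∸ k))
      ≡⟨ exchange (suc (suc n)) (suc k) (binom (suc n) (n ∸ k)) ⟩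
    suc k * (suc (suc n) * binom (suc n) (n ∸ k))
      ≡⟨ cong (suc k *_) (sym (binom-absorption (suc n) (n ∸ k))) ⟩
    suc k * (suc (n ∸ k) * binom (suc (suc n)) (suc (n ∸ k)))
      ≡⟨ cong (λ u → suc k * (suc (n ∸ k) * binom (suc (suc n)) u)) (sym (+-∸-assoc 1 k≤n)) ⟩
    suc k * (suc (n ∸ k) * binom (suc (suc n)) (suc (suc n) ∸ suc k))
      ≡⟨ cong (λ u → suc k * (suc (n ∸ k) * u)) (sym (binom-sym (s≤s (m≤n⇒m≤1+n k≤n)))) ⟩
    suc k * (suc (n ∸ k) * binom (suc (suc n)) (suc k))
      ≡⟨ rotate (suc k) (suc (n ∸ k)) (binom (suc (suc n)) (suc k)) ⟩
    binom (suc (suc n)) (suc k) * suc k * suc (n ∸ k) ∎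
    where
    exchange : ∀ x y z → x * (y * z) ≡ y * (x * z)
    exchange = solve-∀
    rotate : ∀ x y z → x * (y * z) ≡ z * x * y
    rotate = solve-∀

module RangeSum where

  open import Data.Nat as ℕ using (ℕ; zero; suc; _∸_; _<_; _≤_)
  import Data.Nat.Properties as ℕ
  open import Data.Integer using (ℤ; +_; _+_; _*_; 0ℤ)
  open import Data.Integer.Properties using (+-identityˡ; +-identityʳ; +-comm; +-assoc; *-zeroʳ; *-distribˡ-+)
  open import Relation.Binary.PropositionalEquality
  open import Data.Integer.Tactic.RingSolver using (solve-∀)
  open ≡-Reasoning

  ∑ : ℕ → (ℕ → ℤ) → ℤ
  ∑ zero    f = 0ℤ
  ∑ (suc n) f = ∑ n f + f n

  infix 6.5 ∑
  syntax ∑ n (λ i → e) = ∑[ i < n ] e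

  ∑-cong : ∀ n {f g : ℕ → ℤ} → (∀ i → i < n → f i ≡ g i) → ∑ n f ≡ ∑ n g
  ∑-cong zero    f≡g = refl
  ∑-cong (suc n) f≡g = cong₂ _+_ (∑-cong n (λ i i<n → f≡g i (ℕ.m<n⇒m<1+n i<n))) (f≡g n (ℕ.n<1+n n))

  ∑-zero : ∀ n {f : ℕ → ℤ} → (∀ i → i < n → f i ≡ 0ℤ) → ∑ n f ≡ 0ℤ
  ∑-zero n f≡0 = trans (∑-cong n f≡0) (∑-const-0 n)
    where
    ∑-const-0 : ∀ n → ∑[ i < n ] 0ℤ ≡ 0ℤ
    ∑-const-0 zero    = refl
    ∑-const-0 (suc n) = cong (_+ 0ℤ) (∑-const-0 n)

  ∑-+ : ∀ n (f g : ℕ → ℤ) → ∑[ i < n ] (f i + g i) ≡ ∑ n f + ∑ n g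
  ∑-+ zero    f g = refl
  ∑-+ (suc n) f g = trans (cong (_+ (f n + g n)) (∑-+ n f g)) (interchange (∑ n f) (∑ n g) (f n) (g n))
    where
    interchange : ∀ a b c d → (a + b) + (c + d) ≡ (a + c) + (b + d)
    interchange = solve-∀

  ∑-*ˡ : ∀ n c (f : ℕ → ℤ) → ∑[ i < n ] (c * f i) ≡ c * ∑ n f
  ∑-*ˡ zero    c f = sym (*-zeroʳ c)
  ∑-*ˡ (suc n) c f = trans (cong (_+ c * f n) (∑-*ˡ n c f)) (sym (*-distribˡ-+ c (∑ n f) (f n)))

  ∑-suc : ∀ n (f : ℕ → ℤ) → ∑ (suc n) f ≡ f 0 + ∑[ i < n ] f (suc i)
  ∑-suc zero    f = trans (+-identityˡ (f 0)) (sym (+-identityʳ (f 0)))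
  ∑-suc (suc n) f = trans (cong (_+ f (suc n)) (∑-suc n f)) (+-assoc (f 0) _ _)

  ∑-split : ∀ a b (f : ℕ → ℤ) → ∑ (a ℕ.+ b) f ≡ ∑ a f + ∑[ i < b ] f (a ℕ.+ i)
  ∑-split a zero    f = trans (cong (λ m → ∑ m f) (ℕ.+-identityʳ a)) (sym (+-identityʳ _))
  ∑-split a (suc b) f = begin
    ∑ (a ℕ.+ suc b) f                                ≡⟨ cong (λ m → ∑ m f) (ℕ.+-suc a b) ⟩
    ∑ (a ℕ.+ b) f + f (a ℕ.+ b)                      ≡⟨ cong (_+ f (a ℕ.+ b)) (∑-split a b f) ⟩
    ∑ a f + ∑[ i < b ] f (a ℕ.+ i) + f (a ℕ.+ b)     ≡⟨ +-assoc (∑ a f) _ _ ⟩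
    ∑ a f + (∑[ i < b ] f (a ℕ.+ i) + f (a ℕ.+ b))   ∎

  ∑-reverse : ∀ n (f : ℕ → ℤ) → ∑[ i < n ] f (n ∸ suc i) ≡ ∑ n f
  ∑-reverse zero    f = refl
  ∑-reverse (suc n) f = begin
    ∑[ i < n ] f (n ∸ i) + f (n ∸ n)
      ≡⟨ cong (_+ f (n ∸ n)) (∑-cong n (λ i i<n → cong f (ℕ.+-∸-assoc 1 i<n))) ⟩
    ∑[ i < n ] f (suc (n ∸ suc i)) + f (n ∸ n)
      ≡⟨ cong₂ _+_ (∑-reverse n (λ i → f (suc i))) (cong f (ℕ.n∸n≡0 n)) ⟩
    ∑[ i < n ] f (suc i) + f 0
      ≡⟨ +-comm _ (f 0) ⟩
    f 0 + ∑[ i < n ] f (suc i)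
      ≡⟨ sym (∑-suc n f) ⟩
    ∑ (suc n) f ∎

  ∑-triangle-swap : ∀ N (F : ℕ → ℕ → ℤ) →
    ∑[ k < N ] ∑[ i < suc k ] F k i ≡ ∑[ i < N ] ∑[ l < N ∸ i ] F (i ℕ.+ l) i
  ∑-triangle-swap zero    F = refl
  ∑-triangle-swap (suc N) F = begin
    ∑[ k < N ] ∑ (suc k) (F k) + (∑ N (F N) + F N N)
      ≡⟨ cong (_+ (∑ N (F N) + F N N)) (∑-triangle-swap N F) ⟩
    R N + (∑ N (F N) + F N N)
      ≡⟨ sym (+-assoc (R N) (∑ N (F N)) (F N N)) ⟩
    R N + ∑ N (F N) + F N N
      ≡⟨ cong₂ _+_ (sym (∑-+ N _ (F N))) (cong (λ m → F m N) (sym (ℕ.+-identityʳ N))) ⟩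
    ∑[ i < N ] (∑[ l < N ∸ i ] F (i ℕ.+ l) i + F N i) + F (N ℕ.+ 0) N
      ≡⟨ cong₂ _+_ (∑-cong N extend-row) (sym (+-identityˡ (F (N ℕ.+ 0) N))) ⟩
    ∑[ i < N ] ∑[ l < suc N ∸ i ] F (i ℕ.+ l) i + ∑[ l < 1 ] F (N ℕ.+ l) N
      ≡⟨ cong (λ m → R (suc N) + ∑[ l < m ] F (N ℕ.+ l) N) (sym (ℕ.m+n∸n≡m 1 N)) ⟩
    ∑[ i < N ] ∑[ l < suc N ∸ i ] F (i ℕ.+ l) i + ∑[ l < suc N ∸ N ] F (N ℕ.+ l) N ∎
    where
    R : ℕ → ℤ
    R M = ∑[ i < N ] ∑[ l < M ∸ i ] F (i ℕ.+ l) i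
    extend-row : ∀ i → i < N → ∑[ l < N ∸ i ] F (i ℕ.+ l) i + F N i ≡ ∑[ l < suc N ∸ i ] F (i ℕ.+ l) i
    extend-row i i<N = begin
      ∑[ l < N ∸ i ] F (i ℕ.+ l) i + F N i
        ≡⟨ cong (λ m → ∑[ l < N ∸ i ] F (i ℕ.+ l) i + F m i) (sym (ℕ.m+[n∸m]≡n (ℕ.<⇒≤ i<N))) ⟩
      ∑ (suc (N ∸ i)) (λ l → F (i ℕ.+ l) i)
        ≡⟨ cong (λ m → ∑[ l < m ] F (i ℕ.+ l) i) (sym (ℕ.+-∸-assoc 1 (ℕ.<⇒≤ i<N))) ⟩
      ∑[ l < suc N ∸ i ] F (i ℕ.+ l) i ∎

  ∑-palindrome : ∀ l (h : ℕ → ℤ) → (∀ k → k ≤ l ℕ.+ l → h (l ℕ.+ l ∸ k) ≡ h k) →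
                 ∑ (suc (l ℕ.+ l)) h ≡ + 2 * ∑ l h + h l
  ∑-palindrome l h h-sym = begin
    ∑ (suc (l ℕ.+ l)) h
      ≡⟨ cong (λ m → ∑ m h) (sym (ℕ.+-suc l l)) ⟩
    ∑ (l ℕ.+ suc l) h
      ≡⟨ ∑-split l (suc l) h ⟩
    ∑ l h + ∑[ i < suc l ] h (l ℕ.+ i)
      ≡⟨ cong (_+_ (∑ l h)) (∑-suc l (λ i → h (l ℕ.+ i))) ⟩
    ∑ l h + (h (l ℕ.+ 0) + ∑[ i < l ] h (l ℕ.+ suc i))
      ≡⟨ cong₂ (λ x y → ∑ l h + (h x + y)) (ℕ.+-identityʳ l) upper-half ⟩
    ∑ l h + (h l + ∑ l h)
      ≡⟨ double-up (∑ l h) (h l) ⟩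
    + 2 * ∑ l h + h l ∎
    where
    upper-half : ∑[ i < l ] h (l ℕ.+ suc i) ≡ ∑ l h
    upper-half = trans (∑-cong l reflect) (∑-reverse l h)
      where
      reflect : ∀ i → i < l → h (l ℕ.+ suc i) ≡ h (l ∸ suc i)
      reflect i i<l = begin
        h (l ℕ.+ suc i)                   ≡⟨ sym (h-sym (l ℕ.+ suc i) (ℕ.+-monoʳ-≤ l i<l)) ⟩
        h (l ℕ.+ l ∸ (l ℕ.+ suc i))       ≡⟨ cong h (ℕ.[m+n]∸[m+o]≡n∸o l l (suc i)) ⟩
        h (l ∸ suc i)                     ∎
    double-up : ∀ s x → s + (x + s) ≡ + 2 * s + x
    double-up = solve-∀

module TwoAdic where

  open import Data.Nat as ℕ using (ℕ; zero; suc; _<_)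
  import Data.Nat.DivMod as ℕ
  import Data.Nat.Properties as ℕ
  import Data.Nat.Divisibility as ℕ
  open import Data.Nat.Primality using (Prime; euclidsLemma; rough∧∣⇒prime; 2-rough)
  open import Data.Integer using (ℤ; +_; _+_; _*_; 0ℤ; ∣_∣)
  open import Data.Integer.Properties using (pos-*; abs-*; *-identityʳ; *-assoc; *-comm)
  open import Data.Integer.Divisibility.Signed
  open import Data.Sum using (_⊎_; inj₁; inj₂)
  open import Data.Empty using (⊥-elim)
  open import Relation.Nullary using (¬_)
  open import Relation.Binary.Definitions using (tri<; tri≈; tri>)
  open import Relation.Binary.PropositionalEquality
  open ≡-Reasoning
  open import Data.Integer.Tactic.RingSolver using (solve-∀)
  open RangeSum

  2^_ : ℕ → ℤ
  2^ e = + (2 ℕ.^ e)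

  2^-suc : ∀ e → 2^ suc e ≡ + 2 * 2^ e
  2^-suc e = pos-* 2 (2 ℕ.^ e)

  2^-+ : ∀ a b → 2^ (a ℕ.+ b) ≡ 2^ a * 2^ b
  2^-+ a b = trans (cong +_ (ℕ.^-distribˡ-+-* 2 a b)) (pos-* (2 ℕ.^ a) (2 ℕ.^ b))

  -- Congruence modulo 2, as a record so that both sides can be inferred.
  infix 4 _≡₂_
  record _≡₂_ (x y : ℕ) : Set where
    constructor mod2
    field ≡₂⇒%2≡ : x ℕ.% 2 ≡ y ℕ.% 2
  open _≡₂_ public

  ≡₂-reflexive : ∀ {x y} → x ≡ y → x ≡₂ y
  ≡₂-reflexive x≡y = mod2 (cong (ℕ._% 2) x≡y)

  ≡₂-trans : ∀ {x y z} → x ≡₂ y → y ≡₂ z → x ≡₂ z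
  ≡₂-trans (mod2 x≡y) (mod2 y≡z) = mod2 (trans x≡y y≡z)

  ≡₂-+ : ∀ {x x′ y y′} → x ≡₂ x′ → y ≡₂ y′ → x ℕ.+ y ≡₂ x′ ℕ.+ y′
  ≡₂-+ {x} {x′} {y} {y′} (mod2 x≡x′) (mod2 y≡y′) = mod2 (begin
    (x ℕ.+ y) ℕ.% 2                  ≡⟨ ℕ.%-distribˡ-+ x y 2 ⟩
    (x ℕ.% 2 ℕ.+ y ℕ.% 2) ℕ.% 2      ≡⟨ cong₂ (λ u v → (u ℕ.+ v) ℕ.% 2) x≡x′ y≡y′ ⟩
    (x′ ℕ.% 2 ℕ.+ y′ ℕ.% 2) ℕ.% 2    ≡⟨ sym (ℕ.%-distribˡ-+ x′ y′ 2) ⟩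
    (x′ ℕ.+ y′) ℕ.% 2                ∎)

  +*2≡₂ : ∀ x y → x ℕ.+ y ℕ.* 2 ≡₂ x
  +*2≡₂ x y = mod2 (ℕ.[m+kn]%n≡m%n x y 2)

  ≡₂0⇒≡*2 : ∀ {n} → n ≡₂ 0 → n ≡ n ℕ./ 2 ℕ.* 2
  ≡₂0⇒≡*2 {n} (mod2 n%2≡0) = trans (ℕ.m≡m%n+[m/n]*n n 2) (cong (ℕ._+ n ℕ./ 2 ℕ.* 2) n%2≡0)

  Even : ℤ → Set
  Even z = + 2 ∣ z

  Odd : ℤ → Set
  Odd z = ¬ Even z

  even-* : ∀ {a b} → Even (a * b) → Even a ⊎ Even b
  even-* {a} {b} 2∣ab with euclidsLemma ∣ a ∣ ∣ b ∣ 2-prime (subst (2 ℕ.∣_) (abs-* a b) (∣⇒∣ᵤ 2∣ab))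
    where
    2-prime : Prime 2
    2-prime = rough∧∣⇒prime 2-rough ℕ.∣-refl
  ... | inj₁ 2∣a = inj₁ (∣ᵤ⇒∣ 2∣a)
  ... | inj₂ 2∣b = inj₂ (∣ᵤ⇒∣ 2∣b)

  odd-* : ∀ {a b} → Odd a → Odd b → Odd (a * b)
  odd-* odd-a odd-b 2∣ab with even-* 2∣ab
  ... | inj₁ 2∣a = odd-a 2∣a
  ... | inj₂ 2∣b = odd-b 2∣b

  odd-*⁻ʳ : ∀ a {b} → Odd (a * b) → Odd b
  odd-*⁻ʳ a odd-ab 2∣b = odd-ab (∣n⇒∣m*n a 2∣b)

  2^0∣ : ∀ z → 2^ 0 ∣ z
  2^0∣ z = divides z (sym (*-identityʳ z))

  ∣0 : ∀ k → k ∣ 0ℤ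
  ∣0 k = divides 0ℤ refl

  ∣-∑ : ∀ {k} n (f : ℕ → ℤ) → (∀ i → i < n → k ∣ f i) → k ∣ ∑ n f
  ∣-∑ zero    f k∣f = ∣0 _
  ∣-∑ (suc n) f k∣f = ∣m∣n⇒∣m+n (∣-∑ n f (λ i i<n → k∣f i (ℕ.m<n⇒m<1+n i<n))) (k∣f n (ℕ.n<1+n n))

  2^-∣-* : ∀ a b {x y} → 2^ a ∣ x → 2^ b ∣ y → 2^ (a ℕ.+ b) ∣ x * y
  2^-∣-* a b (divides p refl) (divides q refl) =
    divides (p * q) (trans (interchange p (2^ a) q (2^ b)) (cong (p * q *_) (sym (2^-+ a b))))
    where
    interchange : ∀ p u q v → p * u * (q * v) ≡ p * q * (u * v)
    interchange = solve-∀

  2^-∣-2* : ∀ e {x} → 2^ e ∣ x → 2^ suc e ∣ + 2 * x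
  2^-∣-2* e 2^e∣x = subst (_∣ _) (sym (2^-suc e)) (*-monoʳ-∣ (+ 2) 2^e∣x)

  2^-∣-2*⁻ : ∀ e {x} → 2^ suc e ∣ + 2 * x → 2^ e ∣ x
  2^-∣-2*⁻ e 2^e+1∣2x = *-cancelˡ-∣ (+ 2) (subst (_∣ _) (2^-suc e) 2^e+1∣2x)

  2^-∣-cancelˡ : ∀ a {e z} → 2^ (a ℕ.+ e) ∣ 2^ a * z → 2^ e ∣ z
  2^-∣-cancelˡ a {e} 2^a+e∣2^az = *-cancelˡ-∣ (2^ a) {{ℕ.m^n≢0 2 a}} (subst (_∣ _) (2^-+ a e) 2^a+e∣2^az)

  2∣2^suc : ∀ e → + 2 ∣ 2^ suc e
  2∣2^suc e = divides (2^ e) (trans (2^-suc e) (*-comm (+ 2) (2^ e)))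

  odd-cancelˡ : ∀ e {c z} → Odd c → 2^ e ∣ c * z → 2^ e ∣ z
  odd-cancelˡ zero    {z = z} odd-c _           = 2^0∣ z
  odd-cancelˡ (suc e) {c} {z} odd-c 2^e+1∣cz with even-* (∣-trans (2∣2^suc e) 2^e+1∣cz)
  ... | inj₁ 2∣c                = ⊥-elim (odd-c 2∣c)
  ... | inj₂ (divides t refl) =
    subst (_ ∣_) (*-comm (+ 2) t)
      (2^-∣-2* e (odd-cancelˡ e odd-c (2^-∣-2*⁻ e (subst (_ ∣_) (pull-2 c t) 2^e+1∣cz))))
    where
    pull-2 : ∀ c t → c * (t * + 2) ≡ + 2 * (c * t)
    pull-2 = solve-∀

  ≡₂0⇒even : ∀ {n} → n ≡₂ 0 → Even (+ n)
  ≡₂0⇒even {n} (mod2 n%2≡0) = ∣ᵤ⇒∣ (ℕ.m%n≡0⇒n∣m n 2 n%2≡0)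

  ≡₂1⇒odd : ∀ {n} → n ≡₂ 1 → Odd (+ n)
  ≡₂1⇒odd {n} (mod2 n%2≡1) 2∣n = ℕ.0≢1+n (trans (sym (ℕ.n∣m⇒m%n≡0 n 2 (∣⇒∣ᵤ 2∣n))) n%2≡1)

  odd-quotient : ∀ e {y z} → z ≡ y * 2^ e → ¬ (2^ suc e ∣ z) → Odd y
  odd-quotient e {y} refl ¬2^e+1∣z 2∣y = ¬2^e+1∣z (subst (_∣ y * 2^ e) (sym (2^-suc e)) (*-monoˡ-∣ (2^ e) 2∣y))

  2-adic-valuation-unique : ∀ {n k m} → 2 ℕ.^ k ℕ.∣ n → ¬ (2 ℕ.^ suc k ℕ.∣ n) → n ≡ 2 ℕ.^ m → k ≡ m
  2-adic-valuation-unique {n} {k} {m} 2^k∣n ¬2^k+1∣n refl with ℕ.<-cmp k m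
  ... | tri≈ _ k≡m _ = k≡m
  ... | tri< k<m _ _ = ⊥-elim (¬2^k+1∣n (ℕ.divides (2 ℕ.^ (m ℕ.∸ suc k))
          (trans (cong (2 ℕ.^_) (sym (ℕ.m∸n+n≡m k<m))) (ℕ.^-distribˡ-+-* 2 (m ℕ.∸ suc k) (suc k)))))
  ... | tri> _ _ m<k = ⊥-elim (ℕ.<⇒≱ (ℕ.^-monoʳ-< 2 (ℕ.s≤s (ℕ.s≤s ℕ.z≤n)) m<k) (ℕ.∣⇒≤ {{ℕ.m^n≢0 2 m}} 2^k∣n))

  odd-cofactor : ∀ {n} k N → n ≡ N ℕ.* 2 ℕ.^ k → ¬ (2 ℕ.^ suc k ℕ.∣ n) → N ≡₂ 1
  odd-cofactor {n} k N n≡N*2^k ¬2^k+1∣n with N ℕ.% 2 in N%2 | ℕ.m%n<n N 2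
  ... | 0           | _                 = ⊥-elim (¬2^k+1∣n (ℕ.divides (N ℕ./ 2) (begin
    n                              ≡⟨ n≡N*2^k ⟩
    N ℕ.* 2 ℕ.^ k                  ≡⟨ cong (ℕ._* 2 ℕ.^ k) (≡₂0⇒≡*2 {N} (mod2 N%2)) ⟩
    N ℕ./ 2 ℕ.* 2 ℕ.* 2 ℕ.^ k      ≡⟨ ℕ.*-assoc (N ℕ./ 2) 2 (2 ℕ.^ k) ⟩
    N ℕ./ 2 ℕ.* 2 ℕ.^ suc k        ∎)))
  ... | 1           | _                 = mod2 N%2
  ... | suc (suc _) | ℕ.s≤s (ℕ.s≤s ())

module BinomialParity where

  open import Data.Nat
  open import Data.Nat.Properties
  open import Data.Product using (∃-syntax; _,_)
  open import Data.Sum using (_⊎_; inj₁; inj₂)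
  open import Relation.Binary.PropositionalEquality
  open import Data.Nat.Tactic.RingSolver using (solve-∀)
  open ≡-Reasoning
  open Binomial
  open TwoAdic using (_≡₂_; mod2; ≡₂-reflexive; ≡₂-trans; ≡₂-+; +*2≡₂)

  double : ℕ → ℕ
  double zero    = zero
  double (suc n) = suc (suc (double n))

  double≡n+n : ∀ n → double n ≡ n + n
  double≡n+n zero    = refl
  double≡n+n (suc n) = cong suc (trans (cong suc (double≡n+n n)) (sym (+-suc n n)))

  double≡2* : ∀ n → double n ≡ 2 * n
  double≡2* n = trans (double≡n+n n) (cong (n +_) (sym (+-identityʳ n)))

  parity-view : ∀ n → ∃[ j ] (n ≡ double j ⊎ n ≡ suc (double j))
  parity-view zero = 0 , inj₁ refl
  parity-view (suc n) with parity-view n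
  ... | j , inj₁ refl = j , inj₂ refl
  ... | j , inj₂ refl = suc j , inj₁ refl

  -- Applying Pascal's rule twice gives C(n+2,k+2) = C(n,k) + 2 C(n,k+1) + C(n,k+2).
  binom-pascal² : ∀ n k → binom (suc (suc n)) (suc (suc k)) ≡₂ binom n k + binom n (suc (suc k))
  binom-pascal² n k = ≡₂-trans (≡₂-reflexive (regroup (binom n k) (binom n (suc k)) (binom n (suc (suc k)))))
                               (+*2≡₂ (binom n k + binom n (suc (suc k))) (binom n (suc k)))
    where
    regroup : ∀ x y z → x + y + (y + z) ≡ x + z + y * 2
    regroup = solve-∀

  binom[2a,2c+1]≡₂0 : ∀ a c → binom (double a) (suc (double c)) ≡₂ 0
  binom[2a,2c+1]≡₂0 zero    c       = mod2 refl
  binom[2a,2c+1]≡₂0 (suc a) zero    = ≡₂-trans (≡₂-reflexive 2+2a≡a+1*2) (+*2≡₂ 0 (suc a))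
    where
    2+2a≡a+1*2 : binom (double (suc a)) 1 ≡ suc a * 2
    2+2a≡a+1*2 = trans (binom[n,1]≡n (double (suc a))) (trans (double≡2* (suc a)) (*-comm 2 (suc a)))
  binom[2a,2c+1]≡₂0 (suc a) (suc c) =
    ≡₂-trans (binom-pascal² (double a) (suc (double c)))
        (≡₂-+ (binom[2a,2c+1]≡₂0 a c) (binom[2a,2c+1]≡₂0 a (suc c)))

  binom[2a,2c]≡₂binom[a,c] : ∀ a c → binom (double a) (double c) ≡₂ binom a c
  binom[2a,2c]≡₂binom[a,c] zero    zero    = mod2 refl
  binom[2a,2c]≡₂binom[a,c] zero    (suc c) = mod2 refl
  binom[2a,2c]≡₂binom[a,c] (suc a) zero    = mod2 refl
  binom[2a,2c]≡₂binom[a,c] (suc a) (suc c) =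
    ≡₂-trans (binom-pascal² (double a) (double c))
        (≡₂-+ (binom[2a,2c]≡₂binom[a,c] a c) (binom[2a,2c]≡₂binom[a,c] a (suc c)))

  binom[2a+1,2c+1]≡₂binom[a,c] : ∀ a c → binom (suc (double a)) (suc (double c)) ≡₂ binom a c
  binom[2a+1,2c+1]≡₂binom[a,c] a c =
    ≡₂-trans (≡₂-+ (binom[2a,2c]≡₂binom[a,c] a c) (binom[2a,2c+1]≡₂0 a c))
        (≡₂-reflexive (+-identityʳ (binom a c)))

  binom[2^k*n,2^k]≡₂n : ∀ k n → binom (2 ^ k * n) (2 ^ k) ≡₂ n
  binom[2^k*n,2^k]≡₂n zero    n = ≡₂-reflexive (trans (cong (λ m → binom m 1) (+-identityʳ n)) (binom[n,1]≡n n))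
  binom[2^k*n,2^k]≡₂n (suc k) n =
    ≡₂-trans (≡₂-reflexive (cong₂ binom 2^k+1*n≡double (sym (double≡2* (2 ^ k)))))
             (≡₂-trans (binom[2a,2c]≡₂binom[a,c] (2 ^ k * n) (2 ^ k)) (binom[2^k*n,2^k]≡₂n k n))
    where
    2^k+1*n≡double : 2 ^ suc k * n ≡ double (2 ^ k * n)
    2^k+1*n≡double = trans (*-assoc 2 (2 ^ k) n) (sym (double≡2* (2 ^ k * n)))

  binom[2^r,j]≡₂0 : ∀ r j → 0 < j → j < 2 ^ r → binom (2 ^ r) j ≡₂ 0
  binom[2^r,j]≡₂0 zero    (suc j) _ (s≤s ())
  binom[2^r,j]≡₂0 (suc r) j 0<j j<2^r+1 with parity-view j
  ... | c , inj₂ refl = subst (λ m → binom m (suc (double c)) ≡₂ 0) (double≡2* (2 ^ r))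
      (binom[2a,2c+1]≡₂0 (2 ^ r) c)
  ... | suc c , inj₁ refl = subst (λ m → binom m (double (suc c)) ≡₂ 0) (double≡2* (2 ^ r))
          (≡₂-trans (binom[2a,2c]≡₂binom[a,c] (2 ^ r) (suc c)) (binom[2^r,j]≡₂0 r (suc c) (s≤s z≤n) c<2^r))
    where
    c<2^r : suc c < 2 ^ r
    c<2^r = *-cancelˡ-< 2 (suc c) (2 ^ r) (subst (_< 2 ^ suc r) (double≡2* (suc c)) j<2^r+1)

  mersenne : ℕ → ℕ
  mersenne zero    = 0
  mersenne (suc s) = suc (double (mersenne s))

  suc-mersenne : ∀ s → suc (mersenne s) ≡ 2 ^ s
  suc-mersenne zero    = refl
  suc-mersenne (suc s) = trans (cong double (suc-mersenne s)) (double≡2* (2 ^ s))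

  binom-mersenne≡₂1 : ∀ s → binom (mersenne (suc s)) (mersenne s) ≡₂ 1
  binom-mersenne≡₂1 zero    = mod2 refl
  binom-mersenne≡₂1 (suc s) = ≡₂-trans (binom[2a+1,2c+1]≡₂binom[a,c] (mersenne (suc s)) (mersenne s))
      (binom-mersenne≡₂1 s)

  binom-central : ∀ l → binom (suc (suc (double l))) (suc l) ≡ 2 * binom (suc (double l)) l
  binom-central l = begin
    binom (suc (double l)) l + binom (suc (double l)) (suc l)
      ≡⟨ cong (binom (suc (double l)) l +_)
          (trans (binom-sym (s≤s l≤2l)) (cong (binom (suc (double l))) 2l∸l≡l)) ⟩
    binom (suc (double l)) l + binom (suc (double l)) l
      ≡⟨ cong (binom (suc (double l)) l +_) (sym (+-identityʳ _)) ⟩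
    2 * binom (suc (double l)) l ∎
    where
    l≤2l : l ≤ double l
    l≤2l = subst (l ≤_) (sym (double≡n+n l)) (m≤m+n l l)
    2l∸l≡l : double l ∸ l ≡ l
    2l∸l≡l = trans (cong (_∸ l) (double≡n+n l)) (m+n∸m≡n l l)

  double-∸ : ∀ a b → double a ∸ double b ≡ double (a ∸ b)
  double-∸ a       zero    = refl
  double-∸ zero    (suc b) = refl
  double-∸ (suc a) (suc b) = double-∸ a b

  double-cancel-< : ∀ {a b} → double a < double b → a < b
  double-cancel-< {zero}  {suc b} _                 = s≤s z≤n
  double-cancel-< {suc a} {suc b} (s≤s (s≤s 2a<2b)) = s≤s (double-cancel-< 2a<2b)

  suc-double≡₂1 : ∀ n → suc (double n) ≡₂ 1
  suc-double≡₂1 n = ≡₂-trans (≡₂-reflexive (cong suc (trans (double≡2* n) (*-comm 2 n)))) (+*2≡₂ 1 n)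

  mersenne≡2^∸1 : ∀ m → mersenne m ≡ 2 ^ m ∸ 1
  mersenne≡2^∸1 m = trans (sym (m+n∸m≡n 1 (mersenne m))) (cong (_∸ 1) (suc-mersenne m))

module Convolution where

  open import Data.Nat as ℕ using (ℕ; zero; suc; _∸_; _<_; _≤_)
  open import Data.Nat.Induction using (<-rec)
  import Data.Nat.Properties as ℕ
  open import Data.Integer using (ℤ; +_; _+_; _*_; 0ℤ; 1ℤ; NonZero)
  open import Data.Integer.Properties using (+-identityˡ; *-identityˡ; *-identityʳ; *-zeroˡ; *-zeroʳ; *-cancelʳ-≡; pos-*; pos-+)
  open import Relation.Binary.PropositionalEquality
  open import Data.Integer.Tactic.RingSolver using (solve-∀)
  open ≡-Reasoning
  open Binomial
  open RangeSum

  -- Product of exponential generating functions.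
  infixl 7 _⊛_
  _⊛_ : (ℕ → ℤ) → (ℕ → ℤ) → ℕ → ℤ
  (f ⊛ g) n = ∑[ k < suc n ] (+ binom n k * f k * g (n ∸ k))

  δ : ℕ → ℤ
  δ zero    = 1ℤ
  δ (suc n) = 0ℤ

  -- Derivative of an exponential generating function.
  ∂ : (ℕ → ℤ) → ℕ → ℤ
  ∂ f n = f (suc n)

  ∸-suc : ∀ {n k} → k < n → n ∸ k ≡ suc (n ∸ suc k)
  ∸-suc = ℕ.+-∸-assoc 1

  ⊛-last : ∀ f g n → (f ⊛ g) n ≡ ∑[ k < n ] (+ binom n k * f k * g (n ∸ k)) + f n * g 0
  ⊛-last f g n = cong (_+_ (∑[ k < n ] (+ binom n k * f k * g (n ∸ k)))) (begin
    + binom n n * f n * g (n ∸ n) ≡⟨ cong₂ (λ b m → + b * f n * g m) (binom[n,n]≡1 n) (ℕ.n∸n≡0 n) ⟩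
    1ℤ * f n * g 0               ≡⟨ cong (_* g 0) (*-identityˡ (f n)) ⟩
    f n * g 0                    ∎)

  ⊛-identityʳ : ∀ f n → (f ⊛ δ) n ≡ f n
  ⊛-identityʳ f n = begin
    (f ⊛ δ) n
      ≡⟨ ⊛-last f δ n ⟩
    ∑[ k < n ] (+ binom n k * f k * δ (n ∸ k)) + f n * 1ℤ
      ≡⟨ cong₂ _+_ (∑-zero n below) (*-identityʳ (f n)) ⟩
    0ℤ + f n
      ≡⟨ +-identityˡ (f n) ⟩
    f n ∎
    where
    below : ∀ k → k < n → + binom n k * f k * δ (n ∸ k) ≡ 0ℤ
    below k k<n = trans (cong (λ m → + binom n k * f k * δ m) (∸-suc k<n)) (*-zeroʳ (+ binom n k * f k))

  ⊛-congʳ : ∀ f {g g′} n → (∀ i → g i ≡ g′ i) → (f ⊛ g) n ≡ (f ⊛ g′) n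
  ⊛-congʳ f n g≡g′ = ∑-cong (suc n) (λ k _ → cong (+ binom n k * f k *_) (g≡g′ (n ∸ k)))

  ⊛-distribˡ-+ : ∀ f g h n → (f ⊛ (λ i → g i + h i)) n ≡ (f ⊛ g) n + (f ⊛ h) n
  ⊛-distribˡ-+ f g h n =
    trans (∑-cong (suc n) (λ k _ → distrib (+ binom n k * f k) (g (n ∸ k)) (h (n ∸ k)))) (∑-+ (suc n) _ _)
    where
    distrib : ∀ c x y → c * (x + y) ≡ c * x + c * y
    distrib = solve-∀

  ⊛-distribʳ-+ : ∀ f g h n → ((λ i → f i + g i) ⊛ h) n ≡ (f ⊛ h) n + (g ⊛ h) n
  ⊛-distribʳ-+ f g h n =
    trans (∑-cong (suc n) (λ k _ → distrib (+ binom n k) (f k) (g k) (h (n ∸ k)))) (∑-+ (suc n) _ _)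
    where
    distrib : ∀ c x y z → c * (x + y) * z ≡ c * x * z + c * y * z
    distrib = solve-∀

  ⊛-*ˡ : ∀ s f h n → ((λ i → s * f i) ⊛ h) n ≡ s * (f ⊛ h) n
  ⊛-*ˡ s f h n = trans (∑-cong (suc n) (λ k _ → pull (+ binom n k) s (f k) (h (n ∸ k)))) (∑-*ˡ (suc n) s _)
    where
    pull : ∀ c s x y → c * (s * x) * y ≡ s * (c * x * y)
    pull = solve-∀

  ⊛-*ʳ : ∀ s f h n → (f ⊛ (λ i → s * h i)) n ≡ s * (f ⊛ h) n
  ⊛-*ʳ s f h n = trans (∑-cong (suc n) (λ k _ → pull (+ binom n k) s (f k) (h (n ∸ k)))) (∑-*ˡ (suc n) s _)
    where
    pull : ∀ c s x y → c * x * (s * y) ≡ s * (c * x * y)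
    pull = solve-∀

  ⊛-leibniz : ∀ f g n → (f ⊛ g) (suc n) ≡ (∂ f ⊛ g) n + (f ⊛ ∂ g) n
  ⊛-leibniz f g n = begin
    (f ⊛ g) (suc n)
      ≡⟨ ∑-suc (suc n) _ ⟩
    head + ∑[ k < suc n ] (+ binom (suc n) (suc k) * f (suc k) * g (n ∸ k))
      ≡⟨ cong (_+_ head) (trans (∑-cong (suc n) (λ k _ → pascal k)) (∑-+ (suc n) _ _)) ⟩
    head + ((∂ f ⊛ g) n + (∑ n T + T n))
      ≡⟨ cong (λ u → head + ((∂ f ⊛ g) n + (∑ n T + u))) T[n]≡0 ⟩
    head + ((∂ f ⊛ g) n + (∑ n T + 0ℤ))
      ≡⟨ regroup head ((∂ f ⊛ g) n) (∑ n T) ⟩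
    (∂ f ⊛ g) n + (head + ∑ n T)
      ≡⟨ cong (λ u → (∂ f ⊛ g) n + (head + u))
          (∑-cong n (λ k k<n → cong (λ m → + binom n (suc k) * f (suc k) * g m) (∸-suc k<n))) ⟩
    (∂ f ⊛ g) n + (head + ∑[ k < n ] (+ binom n (suc k) * f (suc k) * ∂ g (n ∸ suc k)))
      ≡⟨ cong (_+_ ((∂ f ⊛ g) n)) (sym (∑-suc n _)) ⟩
    (∂ f ⊛ g) n + (f ⊛ ∂ g) n ∎
    where
    head = 1ℤ * f 0 * g (suc n)
    T : ℕ → ℤ
    T k = + binom n (suc k) * f (suc k) * g (n ∸ k)
    pascal : ∀ k → + binom (suc n) (suc k) * f (suc k) * g (n ∸ k)
                 ≡ + binom n k * ∂ f k * g (n ∸ k) + T k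
    pascal k = trans (cong (λ c → c * f (suc k) * g (n ∸ k)) (pos-+ (binom n k) (binom n (suc k))))
                     (distrib (+ binom n k) (+ binom n (suc k)) (f (suc k)) (g (n ∸ k)))
      where
      distrib : ∀ a b x y → (a + b) * x * y ≡ a * x * y + b * x * y
      distrib = solve-∀
    T[n]≡0 : T n ≡ 0ℤ
    T[n]≡0 = trans (cong (λ b → + b * f (suc n) * g (n ∸ n)) (k>n⇒binom≡0 (ℕ.n<1+n n)))
                   (trans (cong (_* g (n ∸ n)) (*-zeroˡ (f (suc n)))) (*-zeroˡ (g (n ∸ n))))
    regroup : ∀ x y z → x + (y + (z + 0ℤ)) ≡ y + (x + z)
    regroup = solve-∀

  ⊛-assoc : ∀ f g h n → ((f ⊛ g) ⊛ h) n ≡ (f ⊛ (g ⊛ h)) n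
  ⊛-assoc f g h n = begin
    ((f ⊛ g) ⊛ h) n
      ≡⟨ ∑-cong (suc n) (λ k _ → expand k) ⟩
    ∑[ k < suc n ] ∑[ i < suc k ] F k i
      ≡⟨ ∑-triangle-swap (suc n) F ⟩
    ∑[ i < suc n ] ∑[ l < suc n ∸ i ] F (i ℕ.+ l) i
      ≡⟨ ∑-cong (suc n) (λ i i≤n → row i (ℕ.≤-pred i≤n)) ⟩
    (f ⊛ (g ⊛ h)) n ∎
    where
    F : ℕ → ℕ → ℤ
    F k i = + binom n k * h (n ∸ k) * (+ binom k i * f i * g (k ∸ i))
    expand : ∀ k → + binom n k * (f ⊛ g) k * h (n ∸ k) ≡ ∑[ i < suc k ] F k i
    expand k = trans (swap (+ binom n k) ((f ⊛ g) k) (h (n ∸ k)))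
                     (sym (∑-*ˡ (suc k) (+ binom n k * h (n ∸ k)) _))
      where
      swap : ∀ x y z → x * y * z ≡ x * z * y
      swap = solve-∀
    entry : ∀ i l → F (i ℕ.+ l) i ≡ + binom n i * f i * (+ binom (n ∸ i) l * g l * h (n ∸ i ∸ l))
    entry i l = begin
      F (i ℕ.+ l) i
        ≡⟨ cong₂ (λ a b → + binom n (i ℕ.+ l) * h a * (+ binom (i ℕ.+ l) i * f i * g b))
                 (sym (ℕ.∸-+-assoc n i l)) (ℕ.m+n∸m≡n i l) ⟩
      + binom n (i ℕ.+ l) * h (n ∸ i ∸ l) * (+ binom (i ℕ.+ l) i * f i * g l)
        ≡⟨ gather (+ binom n (i ℕ.+ l)) (+ binom (i ℕ.+ l) i) (f i) (g l) (h (n ∸ i ∸ l)) ⟩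
      + binom n (i ℕ.+ l) * + binom (i ℕ.+ l) i * (f i * g l * h (n ∸ i ∸ l))
        ≡⟨ cong (_* (f i * g l * h (n ∸ i ∸ l))) subsets ⟩
      + binom n i * + binom (n ∸ i) l * (f i * g l * h (n ∸ i ∸ l))
        ≡⟨ scatter (+ binom n i) (+ binom (n ∸ i) l) (f i) (g l) (h (n ∸ i ∸ l)) ⟩
      + binom n i * f i * (+ binom (n ∸ i) l * g l * h (n ∸ i ∸ l)) ∎
      where
      subsets : + binom n (i ℕ.+ l) * + binom (i ℕ.+ l) i ≡ + binom n i * + binom (n ∸ i) l
      subsets = trans (sym (pos-* (binom n (i ℕ.+ l)) _))
                      (trans (cong +_ (binom-subset-of-subset n i l)) (pos-* (binom n i) _))
      gather : ∀ a b x y z → a * z * (b * x * y) ≡ a * b * (x * y * z)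
      gather = solve-∀
      scatter : ∀ a b x y z → a * b * (x * y * z) ≡ a * x * (b * y * z)
      scatter = solve-∀
    row : ∀ i → i ≤ n → ∑[ l < suc n ∸ i ] F (i ℕ.+ l) i ≡ + binom n i * f i * (g ⊛ h) (n ∸ i)
    row i i≤n = begin
      ∑[ l < suc n ∸ i ] F (i ℕ.+ l) i
        ≡⟨ cong (λ m → ∑[ l < m ] F (i ℕ.+ l) i) (ℕ.+-∸-assoc 1 i≤n) ⟩
      ∑[ l < suc (n ∸ i) ] F (i ℕ.+ l) i
        ≡⟨ ∑-cong (suc (n ∸ i)) (λ l _ → entry i l) ⟩
      ∑[ l < suc (n ∸ i) ] (+ binom n i * f i * (+ binom (n ∸ i) l * g l * h (n ∸ i ∸ l)))
        ≡⟨ ∑-*ˡ (suc (n ∸ i)) (+ binom n i * f i) _ ⟩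
      + binom n i * f i * (g ⊛ h) (n ∸ i) ∎

  ⊛-cancelʳ : ∀ u h .{{_ : NonZero (h 0)}} → (∀ n → (u ⊛ h) n ≡ 0ℤ) → ∀ n → u n ≡ 0ℤ
  ⊛-cancelʳ u h u⊛h≡0 = <-rec (λ n → u n ≡ 0ℤ) step
    where
    step : ∀ n → (∀ {k} → k < n → u k ≡ 0ℤ) → u n ≡ 0ℤ
    step n u<n≡0 = *-cancelʳ-≡ (u n) 0ℤ (h 0) (begin
      u n * h 0
        ≡⟨ sym (+-identityˡ (u n * h 0)) ⟩
      0ℤ + u n * h 0
        ≡⟨ cong (_+ u n * h 0) (sym (∑-zero n below)) ⟩
      ∑[ k < n ] (+ binom n k * u k * h (n ∸ k)) + u n * h 0
        ≡⟨ sym (⊛-last u h n) ⟩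
      (u ⊛ h) n
        ≡⟨ u⊛h≡0 n ⟩
      0ℤ ∎)
      where
      below : ∀ k → k < n → + binom n k * u k * h (n ∸ k) ≡ 0ℤ
      below k k<n = trans (cong (λ x → + binom n k * x * h (n ∸ k)) (u<n≡0 k<n))
                          (trans (cong (_* h (n ∸ k)) (*-zeroʳ (+ binom n k))) (*-zeroˡ (h (n ∸ k))))

module EulerNumbers where

  open import Data.Nat as ℕ using (ℕ; zero; suc; _∸_; _<_; _<?_)
  import Data.Nat.Properties as ℕ
  open import Data.Integer using (ℤ; +_; _+_; _-_; _*_; -_; 0ℤ; 1ℤ)
  open import Data.Integer.Properties using (+-identityˡ)
  open import Relation.Nullary using (yes; no)
  open import Relation.Binary.PropositionalEquality
  open import Data.Integer.Tactic.RingSolver using (solve-∀)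
  open ≡-Reasoning
  open Binomial
  open RangeSum
  open TwoAdic using (2^_; 2^-suc)
  open Convolution

  e²ᵗ+1 : ℕ → ℤ
  e²ᵗ+1 k = 2^ k + δ k

  -- A n = 2ⁿ Eₙ(0), whose exponential generating function 2/(e²ᵗ+1) is characterised by A ⊛ e²ᵗ+1 = 2δ.
  A-step : ℕ → (ℕ → ℤ) → ℤ
  A-step n a = δ n - ∑[ i < n ] (+ binom n i * 2^ (n ∸ suc i) * a i)

  -- A-below n tabulates A below n, which makes the course-of-values recursion structural.
  A-below : ℕ → ℕ → ℤ
  A-below zero    k = 0ℤ
  A-below (suc n) k with k <? n
  ... | yes _ = A-below n k
  ... | no  _ = A-step n (A-below n)

  A : ℕ → ℤ
  A n = A-step n (A-below n)

  A-below≡A : ∀ n k → k < n → A-below n k ≡ A k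
  A-below≡A (suc n) k k<n+1 with k <? n
  ... | yes k<n = A-below≡A n k k<n
  ... | no  k≮n = cong A (sym (ℕ.≤-antisym (ℕ.≤-pred k<n+1) (ℕ.≮⇒≥ k≮n)))

  A-unfold : ∀ n → A n ≡ A-step n A
  A-unfold n = cong (_-_ (δ n)) (∑-cong n (λ i i<n → cong (+ binom n i * 2^ (n ∸ suc i) *_) (A-below≡A n i i<n)))

  A⊛2^ : ∀ n → (A ⊛ 2^_) n ≡ + 2 * δ n - A n
  A⊛2^ n = begin
    (A ⊛ 2^_) n                  ≡⟨ ⊛-last A 2^_ n ⟩
    ∑[ k < n ] (+ binom n k * A k * 2^ (n ∸ k)) + A n * 1ℤ
      ≡⟨ cong₂ _+_ (trans (∑-cong n (λ k k<n → halve k k<n)) (∑-*ˡ n (+ 2) _)) refl ⟩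
    + 2 * S + A n * 1ℤ           ≡⟨ cong (λ a → + 2 * S + a * 1ℤ) (A-unfold n) ⟩
    + 2 * S + (δ n - S) * 1ℤ      ≡⟨ collect (δ n) (A n) S (A-unfold n) ⟩
    + 2 * δ n - A n              ∎
    where
    S = ∑[ i < n ] (+ binom n i * 2^ (n ∸ suc i) * A i)
    halve : ∀ k → k < n → + binom n k * A k * 2^ (n ∸ k) ≡ + 2 * (+ binom n k * 2^ (n ∸ suc k) * A k)
    halve k k<n = trans (cong (λ m → + binom n k * A k * 2^ m) (∸-suc k<n))
                        (trans (cong (+ binom n k * A k *_) (2^-suc (n ∸ suc k)))
                               (swap (+ binom n k) (A k) (2^ (n ∸ suc k))))
      where
      swap : ∀ c a p → c * a * (+ 2 * p) ≡ + 2 * (c * p * a)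
      swap = solve-∀
    collect : ∀ d a s → a ≡ d - s → + 2 * s + (d - s) * 1ℤ ≡ + 2 * d - a
    collect d a s refl = ring d s
      where
      ring : ∀ d s → + 2 * s + (d - s) * 1ℤ ≡ + 2 * d - (d - s)
      ring = solve-∀

  A⊛e²ᵗ+1 : ∀ n → (A ⊛ e²ᵗ+1) n ≡ + 2 * δ n
  A⊛e²ᵗ+1 n = begin
    (A ⊛ e²ᵗ+1) n               ≡⟨ ⊛-distribˡ-+ A 2^_ δ n ⟩
    (A ⊛ 2^_) n + (A ⊛ δ) n     ≡⟨ cong₂ _+_ (A⊛2^ n) (⊛-identityʳ A n) ⟩
    + 2 * δ n - A n + A n       ≡⟨ cancel (δ n) (A n) ⟩
    + 2 * δ n                   ∎
    where
    cancel : ∀ d a → + 2 * d - a + a ≡ + 2 * d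
    cancel = solve-∀

  A-riccati : ∀ n → A (suc n) ≡ (A ⊛ A) n - + 2 * A n
  A-riccati n = begin
    A (suc n)
      ≡⟨ split (A (suc n)) ((A ⊛ A) n) (A n) ⟩
    U n + ((A ⊛ A) n - + 2 * A n)
      ≡⟨ cong (_+ ((A ⊛ A) n - + 2 * A n)) (⊛-cancelʳ U e²ᵗ+1 U⊛e²ᵗ+1≡0 n) ⟩
    0ℤ + ((A ⊛ A) n - + 2 * A n)
      ≡⟨ +-identityˡ _ ⟩
    (A ⊛ A) n - + 2 * A n ∎
    where
    U : ℕ → ℤ
    U k = ∂ A k + - 1ℤ * (A ⊛ A) k + + 2 * A k
    split : ∀ x c a → x ≡ (x + - 1ℤ * c + + 2 * a) + (c - + 2 * a)
    split = solve-∀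
    ∂A⊛e²ᵗ+1 : ∀ n → (∂ A ⊛ e²ᵗ+1) n ≡ - (+ 2 * (+ 2 * δ n - A n))
    ∂A⊛e²ᵗ+1 n = begin
      (∂ A ⊛ e²ᵗ+1) n
        ≡⟨ isolate ((∂ A ⊛ e²ᵗ+1) n) ((A ⊛ ∂ e²ᵗ+1) n) ⟩
      (∂ A ⊛ e²ᵗ+1) n + (A ⊛ ∂ e²ᵗ+1) n - (A ⊛ ∂ e²ᵗ+1) n
        ≡⟨ cong₂ _-_ (sym (⊛-leibniz A e²ᵗ+1 n)) (⊛-congʳ A n ∂e²ᵗ+1) ⟩
      (A ⊛ e²ᵗ+1) (suc n) - (A ⊛ (λ k → + 2 * 2^ k)) n
        ≡⟨ cong₂ _-_ (A⊛e²ᵗ+1 (suc n)) (⊛-*ʳ (+ 2) A 2^_ n) ⟩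
      + 2 * 0ℤ - + 2 * (A ⊛ 2^_) n
        ≡⟨ cong (λ x → + 2 * 0ℤ - + 2 * x) (A⊛2^ n) ⟩
      + 2 * 0ℤ - + 2 * (+ 2 * δ n - A n)
        ≡⟨ negate (+ 2 * δ n - A n) ⟩
      - (+ 2 * (+ 2 * δ n - A n)) ∎
      where
      ∂e²ᵗ+1 : ∀ k → ∂ e²ᵗ+1 k ≡ + 2 * 2^ k
      ∂e²ᵗ+1 k = trans (+-identityʳ′ (2^ suc k)) (2^-suc k)
        where
        +-identityʳ′ : ∀ x → x + 0ℤ ≡ x
        +-identityʳ′ = solve-∀
      isolate : ∀ a b → a ≡ a + b - b
      isolate = solve-∀
      negate : ∀ x → + 2 * 0ℤ - + 2 * x ≡ - (+ 2 * x)
      negate = solve-∀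
    A⊛A⊛e²ᵗ+1 : ∀ n → ((A ⊛ A) ⊛ e²ᵗ+1) n ≡ + 2 * A n
    A⊛A⊛e²ᵗ+1 n = begin
      ((A ⊛ A) ⊛ e²ᵗ+1) n       ≡⟨ ⊛-assoc A A e²ᵗ+1 n ⟩
      (A ⊛ (A ⊛ e²ᵗ+1)) n       ≡⟨ ⊛-congʳ A n A⊛e²ᵗ+1 ⟩
      (A ⊛ (λ k → + 2 * δ k)) n ≡⟨ ⊛-*ʳ (+ 2) A δ n ⟩
      + 2 * (A ⊛ δ) n           ≡⟨ cong (+ 2 *_) (⊛-identityʳ A n) ⟩
      + 2 * A n                 ∎
    U⊛e²ᵗ+1≡0 : ∀ n → (U ⊛ e²ᵗ+1) n ≡ 0ℤ
    U⊛e²ᵗ+1≡0 n = begin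
      (U ⊛ e²ᵗ+1) n
        ≡⟨ ⊛-distribʳ-+ _ _ e²ᵗ+1 n ⟩
      ((λ k → ∂ A k + - 1ℤ * (A ⊛ A) k) ⊛ e²ᵗ+1) n + ((λ k → + 2 * A k) ⊛ e²ᵗ+1) n
        ≡⟨ cong₂ _+_ (⊛-distribʳ-+ (∂ A) _ e²ᵗ+1 n) (⊛-*ˡ (+ 2) A e²ᵗ+1 n) ⟩
      (∂ A ⊛ e²ᵗ+1) n + ((λ k → - 1ℤ * (A ⊛ A) k) ⊛ e²ᵗ+1) n + + 2 * (A ⊛ e²ᵗ+1) n
        ≡⟨ cong₂ (λ x y → (∂ A ⊛ e²ᵗ+1) n + x + + 2 * y) (⊛-*ˡ (- 1ℤ) (A ⊛ A) e²ᵗ+1 n) (A⊛e²ᵗ+1 n) ⟩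
      (∂ A ⊛ e²ᵗ+1) n + - 1ℤ * ((A ⊛ A) ⊛ e²ᵗ+1) n + + 2 * (+ 2 * δ n)
        ≡⟨ cong₂ (λ x y → x + - 1ℤ * y + + 2 * (+ 2 * δ n)) (∂A⊛e²ᵗ+1 n) (A⊛A⊛e²ᵗ+1 n) ⟩
      - (+ 2 * (+ 2 * δ n - A n)) + - 1ℤ * (+ 2 * A n) + + 2 * (+ 2 * δ n)
        ≡⟨ cancel (δ n) (A n) ⟩
      0ℤ ∎
      where
      cancel : ∀ d a → - (+ 2 * (+ 2 * d - a)) + - 1ℤ * (+ 2 * a) + + 2 * (+ 2 * d) ≡ 0ℤ
      cancel = solve-∀

module Genocchi where

  open import Data.Nat as ℕ using (ℕ; zero; suc; _∸_; _<_; _≤_; z≤n; s≤s)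
  import Data.Nat.Properties as ℕ
  open import Data.Nat.Induction using (<-rec)
  open import Data.Integer using (ℤ; +_; _+_; _-_; _*_; 0ℤ; 1ℤ)
  open import Data.Integer.Properties using (*-zeroʳ; *-zeroˡ; +-inverseʳ; pos-*)
  open import Data.Integer.Divisibility.Signed
  open import Data.Product using (_,_)
  open import Data.Sum using (inj₁; inj₂)
  open import Relation.Nullary using (¬_)
  open import Relation.Nullary.Decidable using (from-no)
  open import Relation.Binary.PropositionalEquality
  open import Data.Integer.Tactic.RingSolver using (solve-∀)
  open ≡-Reasoning
  open Binomial
  open BinomialParity
  open RangeSum
  open TwoAdic
  open Convolution
  open EulerNumbers

  A-even-vanish : ∀ l → A (double (suc l)) ≡ 0ℤ
  A-even-vanish = <-rec (λ l → A (double (suc l)) ≡ 0ℤ) step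
    where
    step : ∀ l → (∀ {j} → j < l → A (double (suc j)) ≡ 0ℤ) → A (double (suc l)) ≡ 0ℤ
    step l IH = begin
      A (suc n)                ≡⟨ A-riccati n ⟩
      (A ⊛ A) n - + 2 * A n    ≡⟨ cong (_- + 2 * A n) A⊛A≡2A ⟩
      + 2 * A n - + 2 * A n    ≡⟨ +-inverseʳ (+ 2 * A n) ⟩
      0ℤ                       ∎
      where
      n = suc (double l)
      h : ℕ → ℤ
      h k = + binom n k * A k * A (n ∸ k)
      inner-vanish : ∀ i → i < double l → h (suc i) ≡ 0ℤ
      inner-vanish i i<2l with parity-view i
      ... | j , inj₁ refl = trans (cong (+ binom n (suc (double j)) * A (suc (double j)) *_) A[n∸k]≡0)
          (*-zeroʳ (+ binom n (suc (double j)) * A (suc (double j))))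
        where
        j<l : j < l
        j<l = double-cancel-< i<2l
        A[n∸k]≡0 : A (n ∸ suc (double j)) ≡ 0ℤ
        A[n∸k]≡0 = trans (cong A (trans (double-∸ l j) (cong double (ℕ.+-∸-assoc 1 j<l))))
                         (IH (ℕ.∸-monoʳ-< (s≤s z≤n) j<l))
      ... | j , inj₂ refl = trans (cong (λ a → + binom n (double (suc j)) * a * A (n ∸ double (suc j))) (IH j<l))
                                  (trans (cong (_* A (n ∸ double (suc j))) (*-zeroʳ (+ binom n (double (suc j))))) (*-zeroˡ (A (n ∸ double (suc j)))))
        where
        j<l : j < l
        j<l = double-cancel-< (ℕ.<-trans (ℕ.n<1+n (double j)) i<2l)
      A⊛A≡2A : (A ⊛ A) n ≡ + 2 * A n
      A⊛A≡2A = begin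
        ∑ (suc n) h
          ≡⟨ ∑-suc n h ⟩
        h 0 + (∑[ i < double l ] h (suc i) + h n)
          ≡⟨ cong₂ (λ x y → h 0 + (x + y)) (∑-zero (double l) inner-vanish) h[n]≡A ⟩
        h 0 + (0ℤ + A n)
          ≡⟨ ends (A n) ⟩
        + 2 * A n ∎
        where
        h[n]≡A : h n ≡ A n
        h[n]≡A = trans (cong₂ (λ b m → + b * A n * A m) (binom[n,n]≡1 n) (ℕ.n∸n≡0 n)) (unit (A n))
          where
          unit : ∀ a → 1ℤ * a * 1ℤ ≡ a
          unit = solve-∀
        ends : ∀ a → 1ℤ * 1ℤ * a + (0ℤ + a) ≡ + 2 * a
        ends = solve-∀

  -- g i = (i+1) A i = 2ⁱ Gᵢ₊₁, where Gₘ = 2(1 - 2ᵐ) Bₘ are the Genocchi numbers.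
  g : ℕ → ℤ
  g i = + suc i * A i

  riccati-term : ℕ → ℕ → ℤ
  riccati-term n k = + binom (suc (suc n)) (suc k) * g k * g (n ∸ k)

  g-riccati : ∀ n → + suc n * g (suc n) ≡ ∑ (suc n) (riccati-term n) - + 2 * (+ suc (suc n) * g n)
  g-riccati n = begin
    + suc n * (+ suc (suc n) * A (suc n))
      ≡⟨ cong (λ a → + suc n * (+ suc (suc n) * a)) (A-riccati n) ⟩
    + suc n * (+ suc (suc n) * ((A ⊛ A) n - + 2 * A n))
      ≡⟨ expand (+ suc n) (+ suc (suc n)) ((A ⊛ A) n) (A n) ⟩
    + suc (suc n) * + suc n * (A ⊛ A) n - + 2 * (+ suc (suc n) * g n)
      ≡⟨ cong (_- + 2 * (+ suc (suc n) * g n)) (sym (∑-*ˡ (suc n) (+ suc (suc n) * + suc n) _)) ⟩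
    ∑[ k < suc n ] (+ suc (suc n) * + suc n * (+ binom n k * A k * A (n ∸ k))) - + 2 * (+ suc (suc n) * g n)
      ≡⟨ cong (_- + 2 * (+ suc (suc n) * g n)) (∑-cong (suc n) (λ k k<n+1 → term k (ℕ.≤-pred k<n+1))) ⟩
    ∑ (suc n) (riccati-term n) - + 2 * (+ suc (suc n) * g n) ∎
    where
    expand : ∀ a b c x → a * (b * (c - + 2 * x)) ≡ b * a * c - + 2 * (b * (a * x))
    expand = solve-∀
    term : ∀ k → k ≤ n → + suc (suc n) * + suc n * (+ binom n k * A k * A (n ∸ k)) ≡ riccati-term n k
    term k k≤n = begin
      + suc (suc n) * + suc n * (+ binom n k * A k * A (n ∸ k))
        ≡⟨ gather (+ suc (suc n)) (+ suc n) (+ binom n k) (A k) (A (n ∸ k)) ⟩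
      + suc (suc n) * + suc n * + binom n k * (A k * A (n ∸ k))
        ≡⟨ cong (_* (A k * A (n ∸ k))) absorption ⟩
      + binom (suc (suc n)) (suc k) * + suc k * + suc (n ∸ k) * (A k * A (n ∸ k))
        ≡⟨ scatter (+ binom (suc (suc n)) (suc k)) (+ suc k) (+ suc (n ∸ k)) (A k) (A (n ∸ k)) ⟩
      riccati-term n k ∎
      where
      pos-*³ : ∀ a b c → + (a ℕ.* b ℕ.* c) ≡ + a * + b * + c
      pos-*³ a b c = trans (pos-* (a ℕ.* b) c) (cong (_* + c) (pos-* a b))
      absorption : + suc (suc n) * + suc n * + binom n k ≡ + binom (suc (suc n)) (suc k) * + suc k * + suc (n ∸ k)
      absorption = trans (sym (pos-*³ (suc (suc n)) (suc n) (binom n k)))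
        (trans (cong +_ (binom-double-absorption k≤n)) (pos-*³ (binom (suc (suc n)) (suc k)) (suc k) (suc (n ∸ k))))
      gather : ∀ a b c x y → a * b * (c * x * y) ≡ a * b * c * (x * y)
      gather = solve-∀
      scatter : ∀ c u v x y → c * u * v * (x * y) ≡ c * (u * x) * (v * y)
      scatter = solve-∀

  riccati-term-sym : ∀ {n k} → k ≤ n → riccati-term n (n ∸ k) ≡ riccati-term n k
  riccati-term-sym {n} {k} k≤n = begin
    + binom (suc (suc n)) (suc (n ∸ k)) * g (n ∸ k) * g (n ∸ (n ∸ k))
      ≡⟨ cong₂ (λ b m → + b * g (n ∸ k) * g m) C-sym (ℕ.m∸[m∸n]≡n k≤n) ⟩
    + binom (suc (suc n)) (suc k) * g (n ∸ k) * g k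
      ≡⟨ swap (+ binom (suc (suc n)) (suc k)) (g (n ∸ k)) (g k) ⟩
    riccati-term n k ∎
    where
    C-sym : binom (suc (suc n)) (suc (n ∸ k)) ≡ binom (suc (suc n)) (suc k)
    C-sym = trans (cong (binom (suc (suc n))) (sym (ℕ.+-∸-assoc 1 k≤n)))
                  (sym (binom-sym (s≤s (ℕ.m≤n⇒m≤1+n k≤n))))
    swap : ∀ c x y → c * x * y ≡ c * y * x
    swap = solve-∀

  -- The Riccati sum is symmetric about its middle term, whose binomial coefficient is even.
  riccati-sum-pairing : ∀ l → ∑ (suc (double l)) (riccati-term (double l))
    ≡ + 2 * ∑ l (riccati-term (double l)) + + 2 * (+ binom (suc (double l)) l * g l * g l)
  riccati-sum-pairing l = begin
    ∑ (suc (double l)) h                              ≡⟨ cong (λ m → ∑ (suc m) h) (double≡n+n l) ⟩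
    ∑ (suc (l ℕ.+ l)) h                               ≡⟨ ∑-palindrome l h h-sym ⟩
    + 2 * ∑ l h + h l                                 ≡⟨ cong (_+_ (+ 2 * ∑ l h)) middle ⟩
    + 2 * ∑ l h + + 2 * (+ binom (suc (double l)) l * g l * g l) ∎
    where
    h = riccati-term (double l)
    h-sym : ∀ k → k ≤ l ℕ.+ l → h (l ℕ.+ l ∸ k) ≡ h k
    h-sym k k≤l+l rewrite sym (double≡n+n l) = riccati-term-sym k≤l+l
    middle : h l ≡ + 2 * (+ binom (suc (double l)) l * g l * g l)
    middle = begin
      + binom (suc (suc (double l))) (suc l) * g l * g (double l ∸ l)
        ≡⟨ cong₂ (λ b m → + b * g l * g m) (binom-central l)
            (trans (cong (_∸ l) (double≡n+n l)) (ℕ.m+n∸m≡n l l)) ⟩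
      + (2 ℕ.* binom (suc (double l)) l) * g l * g l
        ≡⟨ cong (λ c → c * g l * g l) (pos-* 2 (binom (suc (double l)) l)) ⟩
      + 2 * + binom (suc (double l)) l * g l * g l
        ≡⟨ assoc (+ binom (suc (double l)) l) (g l) ⟩
      + 2 * (+ binom (suc (double l)) l * g l * g l) ∎
      where
      assoc : ∀ c x → + 2 * c * x * x ≡ + 2 * (c * x * x)
      assoc = solve-∀

  2^i∣g : ∀ i → 2^ i ∣ g i
  2^i∣g = <-rec (λ i → 2^ i ∣ g i) step
    where
    step : ∀ i → (∀ {j} → j < i → 2^ j ∣ g j) → 2^ i ∣ g i
    step zero    _  = 2^0∣ (g 0)
    step (suc n) IH with parity-view n
    ... | l , inj₂ refl = subst (2^ suc n ∣_) (sym g≡0) (∣0 _)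
      where
      g≡0 : g (double (suc l)) ≡ 0ℤ
      g≡0 = trans (cong (+ suc (double (suc l)) *_) (A-even-vanish l)) (*-zeroʳ (+ suc (double (suc l))))
    ... | l , inj₁ refl =
      odd-cancelˡ (suc n) (≡₂1⇒odd (suc-double≡₂1 l))
        (subst (2^ suc n ∣_) (sym (g-riccati n)) (∣m∣n⇒∣m-n sum-div (2^-∣-2* n (∣n⇒∣m*n (+ suc (suc n)) (IH′ n ℕ.≤-refl)))))
      where
      IH′ : ∀ j → j ≤ n → 2^ j ∣ g j
      IH′ j j≤n = IH (s≤s j≤n)
      l≤n : l ≤ n
      l≤n = subst (l ≤_) (sym (double≡n+n l)) (ℕ.m≤m+n l l)
      term-div : ∀ k → k ≤ n → 2^ n ∣ riccati-term n k
      term-div k k≤n = subst (λ e → 2^ e ∣ riccati-term n k) (ℕ.m+[n∸m]≡n k≤n)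
        (2^-∣-* k (n ∸ k) (∣n⇒∣m*n (+ binom (suc (suc n)) (suc k)) (IH′ k k≤n)) (IH′ (n ∸ k) (ℕ.m∸n≤m n k)))
      middle-div : 2^ n ∣ + binom (suc n) l * g l * g l
      middle-div = subst (λ e → 2^ e ∣ + binom (suc n) l * g l * g l) (sym (double≡n+n l))
        (2^-∣-* l l (∣n⇒∣m*n (+ binom (suc n) l) (IH′ l l≤n)) (IH′ l l≤n))
      sum-div : 2^ suc n ∣ ∑ (suc n) (riccati-term n)
      sum-div = subst (2^ suc n ∣_) (sym (riccati-sum-pairing l))
        (∣m∣n⇒∣m+n (2^-∣-2* n (∣-∑ l (riccati-term n) (λ k k<l → term-div k (ℕ.≤-trans (ℕ.<⇒≤ k<l) l≤n))))
                   (2^-∣-2* n middle-div))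

  -- genocchi i is the Genocchi number Gᵢ₊₁.
  abstract
    genocchi : ℕ → ℤ
    genocchi i = quotient (2^i∣g i)

    g≡genocchi*2^ : ∀ i → g i ≡ genocchi i * 2^ i
    g≡genocchi*2^ i = _∣_.equality (2^i∣g i)

  -- Needs g (2ˢ⁺² - 2) = 0, which is why r = 0 and r = 1 are base cases.
  g-mersenne-exact-step : ∀ s → ¬ (2^ suc (mersenne (suc s)) ∣ g (mersenne (suc s)))
                              → ¬ (2^ suc (mersenne (suc (suc s))) ∣ g (mersenne (suc (suc s))))
  g-mersenne-exact-step s IH 2^n+2∣g = odd-* {+ binom (suc n) l * y} {y}
      (odd-* {+ binom (suc n) l} {y} odd-C odd-y) odd-y Cyy-even
    where
    l = mersenne (suc s)
    n = double l
    y = genocchi l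
    M = + binom (suc n) l * g l * g l
    odd-y : Odd y
    odd-y = odd-quotient l (g≡genocchi*2^ l) IH
    odd-C : Odd (+ binom (suc n) l)
    odd-C = ≡₂1⇒odd (binom-mersenne≡₂1 (suc s))
    g[n]≡0 : g n ≡ 0ℤ
    g[n]≡0 = trans (cong (+ suc n *_) (A-even-vanish (double (mersenne s)))) (*-zeroʳ (+ suc n))
    term-div : ∀ k → k < l → 2^ suc n ∣ riccati-term n k
    term-div k k<l = subst (λ e → 2^ e ∣ riccati-term n k) (cong suc (ℕ.m+[n∸m]≡n k≤n))
      (2^-∣-* (suc k) (n ∸ k) (2^-∣-* 1 k C-even (2^i∣g k)) (2^i∣g (n ∸ k)))
      where
      k≤n : k ≤ n
      k≤n = ℕ.≤-trans (ℕ.<⇒≤ k<l) (subst (l ≤_) (sym (double≡n+n l)) (ℕ.m≤m+n l l))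
      2^s+2≡n+2 : 2 ℕ.^ suc (suc s) ≡ suc (suc n)
      2^s+2≡n+2 = sym (suc-mersenne (suc (suc s)))
      C-even : Even (+ binom (suc (suc n)) (suc k))
      C-even = ≡₂0⇒even (subst (λ m → binom m (suc k) ≡₂ 0) 2^s+2≡n+2
          (binom[2^r,j]≡₂0 (suc (suc s)) (suc k) (s≤s z≤n) (subst (suc k <_) (sym 2^s+2≡n+2) (s≤s (s≤s k≤n)))))
    2M-div : 2^ suc (suc n) ∣ + 2 * M
    2M-div = subst (2^ suc (suc n) ∣_)
        (sym (isolate-middle (trans (g-riccati n) (cong (_- + 2 * (+ suc (suc n) * g n)) (riccati-sum-pairing l)))))
      (∣m∣n⇒∣m+n (∣m∣n⇒∣m-n (∣n⇒∣m*n (+ suc n) 2^n+2∣g) (2^-∣-2* (suc n) (∣-∑ l (riccati-term n) term-div)))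
                 (∣n⇒∣m*n (+ 2) (∣n⇒∣m*n (+ suc (suc n)) (subst (2^ suc (suc n) ∣_) (sym g[n]≡0) (∣0 _)))))
      where
      isolate-middle : ∀ {P S M G} → P ≡ + 2 * S + + 2 * M - + 2 * G → + 2 * M ≡ P - + 2 * S + + 2 * G
      isolate-middle {S = S} {M} {G} refl = ring S M G
        where
        ring : ∀ S M G → + 2 * M ≡ + 2 * S + + 2 * M - + 2 * G - + 2 * S + + 2 * G
        ring = solve-∀
    M≡2^n*Cyy : M ≡ 2^ n * (+ binom (suc n) l * y * y)
    M≡2^n*Cyy = begin
      + binom (suc n) l * g l * g l
        ≡⟨ cong (λ x → + binom (suc n) l * x * x) (g≡genocchi*2^ l) ⟩
      + binom (suc n) l * (y * 2^ l) * (y * 2^ l)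
        ≡⟨ regroup (+ binom (suc n) l) y (2^ l) ⟩
      2^ l * 2^ l * (+ binom (suc n) l * y * y)
        ≡⟨ cong (_* (+ binom (suc n) l * y * y)) (trans (sym (2^-+ l l)) (cong 2^_ (sym (double≡n+n l)))) ⟩
      2^ n * (+ binom (suc n) l * y * y) ∎
      where
      regroup : ∀ c y p → c * (y * p) * (y * p) ≡ p * p * (c * y * y)
      regroup = solve-∀
    Cyy-even : Even (+ binom (suc n) l * y * y)
    Cyy-even = 2^-∣-cancelˡ n {1} {+ binom (suc n) l * y * y}
        (subst₂ (λ e z → 2^ e ∣ z) (ℕ.+-comm 1 n) M≡2^n*Cyy (2^-∣-2*⁻ (suc n) 2M-div))

  g-mersenne-exact : ∀ r → ¬ (2^ suc (mersenne r) ∣ g (mersenne r))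
  g-mersenne-exact zero          = from-no (2^ 1 ∣? g 0)
  g-mersenne-exact (suc zero)    = from-no (2^ 2 ∣? g 1)
  g-mersenne-exact (suc (suc s)) = g-mersenne-exact-step s (g-mersenne-exact (suc s))

  genocchi-mersenne-odd : ∀ r → Odd (genocchi (mersenne r))
  genocchi-mersenne-odd r = odd-quotient (mersenne r) (g≡genocchi*2^ (mersenne r)) (g-mersenne-exact r)

module EulerPolynomial where

  open import Data.Nat as ℕ using (ℕ; zero; suc; _∸_; _<_; _≤_; _≟_)
  import Data.Nat.Properties as ℕ
  open import Data.Integer using (ℤ; +_; _+_; _-_; _*_; -_; 0ℤ; 1ℤ)
  open import Data.Integer.Properties using (+-identityˡ; *-zeroʳ; *-zeroˡ; *-identityˡ; pos-*)
  open import Data.Bool using (if_then_else_)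
  open import Data.Sum using (inj₁; inj₂)
  open import Function using (_∘_)
  open import Relation.Nullary using (does)
  open import Relation.Nullary.Decidable using (dec-true; dec-false)
  open import Relation.Binary.PropositionalEquality
  open import Data.Integer.Tactic.RingSolver using (solve-∀)
  open ≡-Reasoning
  open Binomial
  open RangeSum
  open TwoAdic using (2^_)
  open Convolution using (δ; ∸-suc)
  open EulerNumbers

  -- eulerℤ n j = 2ⁿ [xʲ] Eₙ(x), because Eₙ(x) = Σⱼ C(n,j) Eₙ₋ⱼ(0) xʲ.
  eulerℤ : ℕ → ℕ → ℤ
  eulerℤ n j = + binom n j * 2^ j * A (n ∸ j)

  δℤ : ℕ → ℕ → ℤ
  δℤ n j = if does (n ≟ j) then 1ℤ else 0ℤ

  δℤ≡δ[n∸j] : ∀ {n j} → j ≤ n → δℤ n j ≡ δ (n ∸ j)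
  δℤ≡δ[n∸j] {n} {j} j≤n with ℕ.m≤n⇒m<n∨m≡n j≤n
  ... | inj₁ j<n  = trans (cong (if_then 1ℤ else 0ℤ) (dec-false (n ≟ j) (ℕ.<⇒≢ j<n ∘ sym)))
                          (cong δ (sym (∸-suc j<n)))
  ... | inj₂ refl = trans (cong (if_then 1ℤ else 0ℤ) (dec-true (n ≟ n) refl)) (cong δ (sym (ℕ.n∸n≡0 n)))

  δℤ-> : ∀ {n j} → n < j → δℤ n j ≡ 0ℤ
  δℤ-> {n} {j} n<j = cong (if_then 1ℤ else 0ℤ) (dec-false (n ≟ j) (ℕ.<⇒≢ n<j))

  eulerℤ-vanish : ∀ {n j} → n < j → eulerℤ n j ≡ 0ℤ
  eulerℤ-vanish {n} {j} n<j =
    trans (cong (λ b → + b * 2^ j * A (n ∸ j)) (k>n⇒binom≡0 n<j))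
          (trans (cong (_* A (n ∸ j)) (*-zeroˡ (2^ j))) (*-zeroˡ (A (n ∸ j))))

  -- Multiplying Eₙ = xⁿ - ½ Σₖ₍ₙ C(n,k) Eₖ by 2ⁿ.
  eulerℤ-rec : ∀ m j → eulerℤ (suc m) j
    ≡ 2^ suc m * δℤ (suc m) j - ∑[ k < suc m ] (+ binom (suc m) k * 2^ (m ∸ k) * eulerℤ k j)
  eulerℤ-rec m j with ℕ.<-≤-connex (suc m) j
  ... | inj₁ n<j = begin
    eulerℤ (suc m) j
      ≡⟨ eulerℤ-vanish n<j ⟩
    0ℤ
      ≡⟨ zero-form (2^ suc m) ⟩
    2^ suc m * 0ℤ - 0ℤ
      ≡⟨ sym (cong₂ (λ x y → 2^ suc m * x - y) (δℤ-> n<j) (∑-zero (suc m) T≡0)) ⟩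
    2^ suc m * δℤ (suc m) j - ∑ (suc m) T ∎
    where
    T : ℕ → ℤ
    T k = + binom (suc m) k * 2^ (m ∸ k) * eulerℤ k j
    T≡0 : ∀ k → k < suc m → T k ≡ 0ℤ
    T≡0 k k<n = trans (cong (+ binom (suc m) k * 2^ (m ∸ k) *_) (eulerℤ-vanish (ℕ.<-trans k<n n<j)))
                      (*-zeroʳ (+ binom (suc m) k * 2^ (m ∸ k)))
    zero-form : ∀ p → 0ℤ ≡ p * 0ℤ - 0ℤ
    zero-form = solve-∀
  ... | inj₂ j≤n = begin
    c * A m′
      ≡⟨ distribute c (A m′) (δ m′) ⟩
    c * δ m′ - c * (δ m′ - A m′)
      ≡⟨ cong₂ (λ x y → x - c * y) (sym 2^n*δ≡c*δ) δ-A≡S ⟩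
    2^ n * δ m′ - c * S
      ≡⟨ cong₂ (λ x y → 2^ n * x - y) (sym (δℤ≡δ[n∸j] j≤n)) (sym ∑T≡c*S) ⟩
    2^ n * δℤ n j - ∑ n T ∎
    where
    n  = suc m
    m′ = n ∸ j
    c  = + binom n j * 2^ j
    S  = ∑[ i < m′ ] (+ binom m′ i * 2^ (m′ ∸ suc i) * A i)
    T : ℕ → ℤ
    T k = + binom n k * 2^ (m ∸ k) * eulerℤ k j
    distribute : ∀ c a d → c * a ≡ c * d - c * (d - a)
    distribute = solve-∀
    δ-A≡S : δ m′ - A m′ ≡ S
    δ-A≡S = trans (cong (_-_ (δ m′)) (A-unfold m′)) (cancel (δ m′) S)
      where
      cancel : ∀ d s → d - (d - s) ≡ s
      cancel = solve-∀
    2^n*δ≡c*δ : 2^ n * δ m′ ≡ c * δ m′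
    2^n*δ≡c*δ with m′ in eq
    ... | suc _ = trans (*-zeroʳ (2^ n)) (sym (*-zeroʳ c))
    ... | zero  = cong (_* 1ℤ) (sym (begin
      + binom n j * 2^ j   ≡⟨ cong (λ i → + binom n i * 2^ i) (ℕ.≤-antisym j≤n (ℕ.m∸n≡0⇒m≤n eq)) ⟩
      + binom n n * 2^ n   ≡⟨ cong (λ b → + b * 2^ n) (binom[n,n]≡1 n) ⟩
      1ℤ * 2^ n            ≡⟨ *-identityˡ (2^ n) ⟩
      2^ n                 ∎))
    shifted : ∀ i → T (j ℕ.+ i) ≡ c * (+ binom m′ i * 2^ (m′ ∸ suc i) * A i)
    shifted i = begin
      + binom n (j ℕ.+ i) * 2^ (m ∸ (j ℕ.+ i)) * (+ binom (j ℕ.+ i) j * 2^ j * A ((j ℕ.+ i) ∸ j))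
        ≡⟨ cong₂ (λ x y → + binom n (j ℕ.+ i) * 2^ x * (+ binom (j ℕ.+ i) j * 2^ j * A y)) exponent
            (ℕ.m+n∸m≡n j i) ⟩
      + binom n (j ℕ.+ i) * 2^ (m′ ∸ suc i) * (+ binom (j ℕ.+ i) j * 2^ j * A i)
        ≡⟨ gather (+ binom n (j ℕ.+ i)) (+ binom (j ℕ.+ i) j) (2^ (m′ ∸ suc i)) (2^ j) (A i) ⟩
      + binom n (j ℕ.+ i) * + binom (j ℕ.+ i) j * (2^ j * 2^ (m′ ∸ suc i) * A i)
        ≡⟨ cong (_* (2^ j * 2^ (m′ ∸ suc i) * A i)) subsets ⟩
      + binom n j * + binom m′ i * (2^ j * 2^ (m′ ∸ suc i) * A i)
        ≡⟨ scatter (+ binom n j) (+ binom m′ i) (2^ j) (2^ (m′ ∸ suc i)) (A i) ⟩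
      c * (+ binom m′ i * 2^ (m′ ∸ suc i) * A i) ∎
      where
      exponent : m ∸ (j ℕ.+ i) ≡ m′ ∸ suc i
      exponent = sym (trans (ℕ.∸-+-assoc n j (suc i)) (cong (n ∸_) (ℕ.+-suc j i)))
      subsets : + binom n (j ℕ.+ i) * + binom (j ℕ.+ i) j ≡ + binom n j * + binom m′ i
      subsets = trans (sym (pos-* (binom n (j ℕ.+ i)) (binom (j ℕ.+ i) j)))
                      (trans (cong +_ (binom-subset-of-subset n j i)) (pos-* (binom n j) (binom m′ i)))
      gather : ∀ a b p q x → a * p * (b * q * x) ≡ a * b * (q * p * x)
      gather = solve-∀
      scatter : ∀ a b q p x → a * b * (q * p * x) ≡ a * q * (b * p * x)
      scatter = solve-∀
    ∑T≡c*S : ∑ n T ≡ c * S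
    ∑T≡c*S = begin
      ∑ n T
        ≡⟨ cong (λ k → ∑ k T) (sym (ℕ.m+[n∸m]≡n j≤n)) ⟩
      ∑ (j ℕ.+ m′) T
        ≡⟨ ∑-split j m′ T ⟩
      ∑ j T + ∑[ i < m′ ] T (j ℕ.+ i)
        ≡⟨ cong₂ _+_ (∑-zero j T<j≡0) (trans (∑-cong m′ (λ i _ → shifted i)) (∑-*ˡ m′ c _)) ⟩
      0ℤ + c * S
        ≡⟨ +-identityˡ (c * S) ⟩
      c * S ∎
      where
      T<j≡0 : ∀ k → k < j → T k ≡ 0ℤ
      T<j≡0 k k<j = trans (cong (+ binom n k * 2^ (m ∸ k) *_) (eulerℤ-vanish k<j))
          (*-zeroʳ (+ binom n k * 2^ (m ∸ k)))

module EulerRational where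

  open import Level using (0ℓ)
  open import Data.Nat as ℕ using (ℕ; zero; suc; _∸_; _<_; _≟_)
  import Data.Nat.Properties as ℕ
  open import Data.Nat.Induction using (<-rec)
  open import Data.Nat.Combinatorics using (_C_)
  import Data.Integer as ℤ
  open import Data.Integer using (ℤ; +_; 0ℤ; 1ℤ)
  import Data.Integer.Properties as ℤ
  open import Data.Rational using (ℚ; 0ℚ; 1ℚ; ½; _+_; _-_; _*_; -_; _/_; toℚᵘ)
  open import Data.Rational.Properties
    using (toℚᵘ-injective; toℚᵘ-cong; toℚᵘ-fromℚᵘ; toℚᵘ-homo-+; toℚᵘ-homo-*; toℚᵘ-homo‿-; +-*-commutativeRing)
  import Data.Rational.Properties as ℚ
  import Data.Rational.Unnormalised as ℚᵘ
  import Data.Rational.Unnormalised.Properties as ℚᵘ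
  open import Data.List using ([]; _∷_; _++_; [_]; map; upTo; zipWith)
  open import Data.List.Properties using (map-++; upTo-∷ʳ)
  open import Function using (_∘_)
  open import Data.Bool using (true; false; if_then_else_)
  open import Data.Maybe using (nothing)
  open import Relation.Nullary using (does)
  open import Relation.Binary.PropositionalEquality hiding ([_])
  open import Tactic.RingSolver.Core.AlmostCommutativeRing using (AlmostCommutativeRing; fromCommutativeRing)
  open import Tactic.RingSolver using (solve-∀)
  open import Data.Integer.Tactic.RingSolver renaming (solve-∀ to ℤ-solve-∀)
  open ≡-Reasoning
  open import Defs
  open Binomial
  open RangeSum
  open TwoAdic using (2^_; 2^-suc)
  open EulerPolynomial

  ℚ-ring : AlmostCommutativeRing 0ℓ 0ℓ
  ℚ-ring = fromCommutativeRing +-*-commutativeRing (λ _ → nothing)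

  ι : ℤ → ℚ
  ι z = z / 1

  toℚᵘ-ι : ∀ z → toℚᵘ (ι z) ℚᵘ.≃ ℚᵘ.mkℚᵘ z 0
  toℚᵘ-ι z = toℚᵘ-fromℚᵘ (ℚᵘ.mkℚᵘ z 0)

  ι-+ : ∀ a b → ι (a ℤ.+ b) ≡ ι a + ι b
  ι-+ a b = toℚᵘ-injective (ℚᵘ.≃-trans (toℚᵘ-ι (a ℤ.+ b)) (ℚᵘ.≃-trans (ℚᵘ.*≡* (cross a b))
    (ℚᵘ.≃-sym (ℚᵘ.≃-trans (toℚᵘ-homo-+ (ι a) (ι b)) (ℚᵘ.+-cong (toℚᵘ-ι a) (toℚᵘ-ι b))))))
    where
    cross : ∀ a b → (a ℤ.+ b) ℤ.* + 1 ≡ (a ℤ.* + 1 ℤ.+ b ℤ.* + 1) ℤ.* + 1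
    cross = ℤ-solve-∀

  ι-* : ∀ a b → ι (a ℤ.* b) ≡ ι a * ι b
  ι-* a b = toℚᵘ-injective (ℚᵘ.≃-trans (toℚᵘ-ι (a ℤ.* b)) (ℚᵘ.≃-trans (ℚᵘ.*≡* refl)
    (ℚᵘ.≃-sym (ℚᵘ.≃-trans (toℚᵘ-homo-* (ι a) (ι b)) (ℚᵘ.*-cong (toℚᵘ-ι a) (toℚᵘ-ι b))))))

  ι-neg : ∀ a → ι (ℤ.- a) ≡ - ι a
  ι-neg a = toℚᵘ-injective (ℚᵘ.≃-trans (toℚᵘ-ι (ℤ.- a))
    (ℚᵘ.≃-sym (ℚᵘ.≃-trans (toℚᵘ-homo‿- (ι a)) (ℚᵘ.-‿cong (toℚᵘ-ι a)))))

  ι-sub : ∀ a b → ι (a ℤ.- b) ≡ ι a - ι b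
  ι-sub a b = trans (ι-+ a (ℤ.- b)) (cong (_+_ (ι a)) (ι-neg b))

  ½^ : ℕ → ℚ
  ½^ zero    = 1ℚ
  ½^ (suc e) = ½ * ½^ e

  ι[2^e]*½^e≡1 : ∀ e → ι (2^ e) * ½^ e ≡ 1ℚ
  ι[2^e]*½^e≡1 zero    = refl
  ι[2^e]*½^e≡1 (suc e) = begin
    ι (2^ suc e) * (½ * ½^ e)               ≡⟨ cong (λ z → ι z * (½ * ½^ e)) (2^-suc e) ⟩
    ι (+ 2 ℤ.* 2^ e) * (½ * ½^ e)           ≡⟨ cong (_* (½ * ½^ e)) (ι-* (+ 2) (2^ e)) ⟩
    ι (+ 2) * ι (2^ e) * (½ * ½^ e)         ≡⟨ interchange (ι (+ 2)) (ι (2^ e)) ½ (½^ e) ⟩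
    ι (+ 2) * ½ * (ι (2^ e) * ½^ e)         ≡⟨ cong (ι (+ 2) * ½ *_) (ι[2^e]*½^e≡1 e) ⟩
    ι (+ 2) * ½ * 1ℚ                        ≡⟨⟩
    1ℚ                                      ∎
    where
    interchange : ∀ a b c d → a * b * (c * d) ≡ a * c * (b * d)
    interchange = solve-∀ ℚ-ring

  ½^-split : ∀ m k → ½^ k ≡ ι (2^ m) * ½^ (m ℕ.+ k)
  ½^-split zero    k = sym (ℚ.*-identityˡ (½^ k))
  ½^-split (suc m) k = begin
    ½^ k
      ≡⟨ ½^-split m k ⟩
    ι (2^ m) * ½^ (m ℕ.+ k)
      ≡⟨ insert-2*½ (ι (2^ m)) (½^ (m ℕ.+ k)) ⟩
    ι (+ 2) * ι (2^ m) * (½ * ½^ (m ℕ.+ k))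
      ≡⟨ cong (_* ½^ (suc m ℕ.+ k)) (sym (trans (cong ι (2^-suc m)) (ι-* (+ 2) (2^ m)))) ⟩
    ι (2^ suc m) * ½^ (suc m ℕ.+ k) ∎
    where
    insert-2*½ : ∀ p h → p * h ≡ ι (+ 2) * p * (½ * h)
    insert-2*½ = solve-∀ ℚ-ring

  sumℚ-++-[] : ∀ xs x → sumℚ (xs ++ [ x ]) ≡ sumℚ xs + x
  sumℚ-++-[] []       x = ℚ.+-comm x 0ℚ
  sumℚ-++-[] (y ∷ ys) x = trans (cong (_+_ y) (sumℚ-++-[] ys x)) (assoc y (sumℚ ys) x)
    where
    assoc : ∀ a b c → a + (b + c) ≡ a + b + c
    assoc = solve-∀ ℚ-ring

  sumℚ-upTo : ∀ n (F : ℕ → ℚ) (f : ℕ → ℤ) c → (∀ i → i < n → F i ≡ ι (f i) * c) →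
              sumℚ (map F (upTo n)) ≡ ι (∑ n f) * c
  sumℚ-upTo zero    F f c F≡fc = sym (ℚ.*-zeroˡ c)
  sumℚ-upTo (suc n) F f c F≡fc = begin
    sumℚ (map F (upTo (suc n)))
      ≡⟨ cong (sumℚ ∘ map F) (sym (upTo-∷ʳ n)) ⟩
    sumℚ (map F (upTo n ++ [ n ]))
      ≡⟨ cong sumℚ (map-++ F (upTo n) [ n ]) ⟩
    sumℚ (map F (upTo n) ++ [ F n ])
      ≡⟨ sumℚ-++-[] (map F (upTo n)) (F n) ⟩
    sumℚ (map F (upTo n)) + F n
      ≡⟨ cong₂ _+_ (sumℚ-upTo n F f c (λ i i<n → F≡fc i (ℕ.m<n⇒m<1+n i<n))) (F≡fc n (ℕ.n<1+n n)) ⟩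
    ι (∑ n f) * c + ι (f n) * c
      ≡⟨ distrib (ι (∑ n f)) (ι (f n)) c ⟩
    (ι (∑ n f) + ι (f n)) * c
      ≡⟨ cong (_* c) (sym (ι-+ (∑ n f) (f n))) ⟩
    ι (∑ (suc n) f) * c ∎
    where
    distrib : ∀ a b c → a * c + b * c ≡ (a + b) * c
    distrib = solve-∀ ℚ-ring

  eulerList≡map-euler : ∀ n → eulerList n ≡ map euler (upTo n)
  eulerList≡map-euler zero    = refl
  eulerList≡map-euler (suc n) = begin
    eulerList n ++ [ euler n ]             ≡⟨ cong (_++ [ euler n ]) (eulerList≡map-euler n) ⟩
    map euler (upTo n) ++ [ euler n ]      ≡⟨ sym (map-++ euler (upTo n) [ n ]) ⟩
    map euler (upTo n ++ [ n ])            ≡⟨ cong (map euler) (upTo-∷ʳ n) ⟩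
    map euler (upTo (suc n))               ∎

  zipWith-map : ∀ {A B C : Set} (f : A → B → C) (g : A → B) xs →
                zipWith f xs (map g xs) ≡ map (λ x → f x (g x)) xs
  zipWith-map f g []       = refl
  zipWith-map f g (x ∷ xs) = cong (f x (g x) ∷_) (zipWith-map f g xs)

  ι-if : ∀ b → ι (if b then 1ℤ else 0ℤ) ≡ (if b then 1ℚ else 0ℚ)
  ι-if true  = refl
  ι-if false = refl

  euler≡eulerℤ : ∀ n j → euler n j ≡ ι (eulerℤ n j) * ½^ n
  euler≡eulerℤ = <-rec (λ n → ∀ j → euler n j ≡ ι (eulerℤ n j) * ½^ n) step
    where
    step : ∀ n → (∀ {k} → k < n → ∀ j → euler k j ≡ ι (eulerℤ k j) * ½^ k) → ∀ j → euler n j ≡ ι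
        (eulerℤ n j) * ½^ n
    step zero    _  zero    = refl
    step zero    _  (suc j) = refl
    step (suc m) IH j = begin
      euler n j
        ≡⟨ cong (λ es → eulerStep n es j) (eulerList≡map-euler n) ⟩
      ι𝟙 - ½ * sumℚ (zipWith (λ k e → ℕ→ℚ (n C k) * e j) (upTo n) (map euler (upTo n)))
        ≡⟨ cong (λ xs → ι𝟙 - ½ * sumℚ xs) (zipWith-map (λ k e → ℕ→ℚ (n C k) * e j) euler (upTo n)) ⟩
      ι𝟙 - ½ * sumℚ (map (λ k → ℕ→ℚ (n C k) * euler k j) (upTo n))
        ≡⟨ cong (λ s → ι𝟙 - ½ * s) (sumℚ-upTo n _ T (½^ m) term) ⟩
      ι𝟙 - ½ * (ι (∑ n T) * ½^ m)
        ≡⟨ cong (λ x → x - ½ * (ι (∑ n T) * ½^ m)) (sym (ι-if (does (n ≟ j)))) ⟩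
      ι (δℤ n j) - ½ * (ι (∑ n T) * ½^ m)
        ≡⟨ cong (λ x → x - ½ * (ι (∑ n T) * ½^ m))
            (sym (trans (cong (ι (δℤ n j) *_) (ι[2^e]*½^e≡1 n)) (ℚ.*-identityʳ (ι (δℤ n j))))) ⟩
      ι (δℤ n j) * (ι (2^ n) * ½^ n) - ½ * (ι (∑ n T) * ½^ m)
        ≡⟨ factor (ι (2^ n)) (ι (δℤ n j)) (ι (∑ n T)) ½ (½^ m) ⟩
      (ι (2^ n) * ι (δℤ n j) - ι (∑ n T)) * ½^ n
        ≡⟨ cong (_* ½^ n) (sym (trans (ι-sub (2^ n ℤ.* δℤ n j) (∑ n T)) (cong (_- ι (∑ n T)) (ι-* (2^ n) (δℤ n j))))) ⟩
      ι (2^ n ℤ.* δℤ n j ℤ.- ∑ n T) * ½^ n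
        ≡⟨ cong (λ z → ι z * ½^ n) (sym (eulerℤ-rec m j)) ⟩
      ι (eulerℤ n j) * ½^ n ∎
      where
      n = suc m
      ι𝟙 = if does (n ≟ j) then 1ℚ else 0ℚ
      T : ℕ → ℤ
      T k = + binom n k ℤ.* 2^ (m ∸ k) ℤ.* eulerℤ k j
      factor : ∀ p d s h w → d * (p * (h * w)) - h * (s * w) ≡ (p * d - s) * (h * w)
      factor = solve-∀ ℚ-ring
      term : ∀ k → k < n → ℕ→ℚ (n C k) * euler k j ≡ ι (T k) * ½^ m
      term k k<n = begin
        ℕ→ℚ (n C k) * euler k j
          ≡⟨ cong₂ _*_ (cong (ι ∘ +_) (sym (binom≡C n k))) (IH k<n j) ⟩
        ι (+ binom n k) * (ι (eulerℤ k j) * ½^ k)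
          ≡⟨ cong (λ x → ι (+ binom n k) * (ι (eulerℤ k j) * x))
              (trans (½^-split (m ∸ k) k) (cong (λ e → ι (2^ (m ∸ k)) * ½^ e) (ℕ.m∸n+n≡m (ℕ.≤-pred k<n)))) ⟩
        ι (+ binom n k) * (ι (eulerℤ k j) * (ι (2^ (m ∸ k)) * ½^ m))
          ≡⟨ rearrange (ι (+ binom n k)) (ι (eulerℤ k j)) (ι (2^ (m ∸ k))) (½^ m) ⟩
        ι (+ binom n k) * ι (2^ (m ∸ k)) * ι (eulerℤ k j) * ½^ m
          ≡⟨ cong (_* ½^ m) (sym (trans (ι-* (+ binom n k ℤ.* 2^ (m ∸ k)) (eulerℤ k j))
                                        (cong (_* ι (eulerℤ k j)) (ι-* (+ binom n k) (2^ (m ∸ k)))))) ⟩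
        ι (T k) * ½^ m ∎
        where
        rearrange : ∀ c q p w → c * (q * (p * w)) ≡ c * p * q * w
        rearrange = solve-∀ ℚ-ring

  ι-injective : ∀ {a b} → ι a ≡ ι b → a ≡ b
  ι-injective {a} {b} ιa≡ιb with ℚᵘ.≃-trans (ℚᵘ.≃-sym (toℚᵘ-ι a)) (ℚᵘ.≃-trans (toℚᵘ-cong ιa≡ιb) (toℚᵘ-ι b))
  ... | ℚᵘ.*≡* a*1≡b*1 = trans (sym (ℤ.*-identityʳ a)) (trans a*1≡b*1 (ℤ.*-identityʳ b))

module ShiftedEuler where

  open import Data.Nat as ℕ using (ℕ; zero; suc; _∸_; _<_; _≤_; z≤n; s≤s)
  import Data.Nat.Properties as ℕ
  import Data.Integer as ℤ
  open import Data.Integer using (ℤ; +_; 0ℤ)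
  import Data.Integer.Properties as ℤ
  open import Data.Rational using (ℚ; 1ℚ; _+_; _-_; _*_)
  import Data.Rational.Properties as ℚ
  open import Data.Product using (∃-syntax; _,_)
  open import Relation.Binary.PropositionalEquality
  open import Tactic.RingSolver using (solve-∀)
  open import Data.Integer.Tactic.RingSolver renaming (solve-∀ to ℤ-solve-∀)
  open ≡-Reasoning
  open import Defs
  open Binomial
  open RangeSum
  open TwoAdic using (2^_; 2^-+)
  open Convolution using (δ; _⊛_)
  open EulerNumbers
  open Genocchi using (g; genocchi; g≡genocchi*2^)
  open EulerPolynomial
  open EulerRational

  eulerℤ-reflect : ∀ {n i} → i ≤ n → eulerℤ n (n ∸ i) ≡ + binom n i ℤ.* 2^ (n ∸ i) ℤ.* A i
  eulerℤ-reflect {n} {i} i≤n = cong₂ (λ b m → + b ℤ.* 2^ (n ∸ i) ℤ.* A m) (sym (binom-sym i≤n)) (ℕ.m∸[m∸n]≡n i≤n)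

  -- 2ⁿ Eₙ(1) = 2 δₙ - A n, i.e. Eₙ(1) = -Eₙ(0) for n ≥ 1.
  ∑-eulerℤ : ∀ n → ∑ (suc n) (eulerℤ n) ≡ + 2 ℤ.* δ n ℤ.- A n
  ∑-eulerℤ n = begin
    ∑ (suc n) (eulerℤ n)
      ≡⟨ sym (∑-reverse (suc n) (eulerℤ n)) ⟩
    ∑[ i < suc n ] eulerℤ n (n ∸ i)
      ≡⟨ ∑-cong (suc n) (λ i i<n+1 → trans (eulerℤ-reflect (ℕ.≤-pred i<n+1)) (swap (+ binom n i) (2^ (n ∸ i)) (A i))) ⟩
    (A ⊛ 2^_) n
      ≡⟨ A⊛2^ n ⟩
    + 2 ℤ.* δ n ℤ.- A n ∎
    where
    swap : ∀ c p a → c ℤ.* p ℤ.* a ≡ c ℤ.* a ℤ.* p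
    swap = ℤ-solve-∀

  eulerShift-const : ∀ n → eulerShift (suc n) 0 ≡ ι (+ 2 ℤ.* A (suc n)) * ½^ (suc n)
  eulerShift-const n = begin
    euler N 0 - evalAt1 N (euler N)
      ≡⟨ cong₂ _-_ (euler≡eulerℤ N 0) value-at-1 ⟩
    ι (eulerℤ N 0) * ½^ N - ι (∑ (suc N) (eulerℤ N)) * ½^ N
      ≡⟨ factor (ι (eulerℤ N 0)) (ι (∑ (suc N) (eulerℤ N))) (½^ N) ⟩
    (ι (eulerℤ N 0) - ι (∑ (suc N) (eulerℤ N))) * ½^ N
      ≡⟨ cong (_* ½^ N) (sym (ι-sub (eulerℤ N 0) (∑ (suc N) (eulerℤ N)))) ⟩
    ι (eulerℤ N 0 ℤ.- ∑ (suc N) (eulerℤ N)) * ½^ N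
      ≡⟨ cong (λ z → ι z * ½^ N) (trans (cong (ℤ._-_ (eulerℤ N 0)) (∑-eulerℤ N)) (cancel (A N))) ⟩
    ι (+ 2 ℤ.* A N) * ½^ N ∎
    where
    N = suc n
    factor : ∀ a b w → a * w - b * w ≡ (a - b) * w
    factor = solve-∀ ℚ-ring
    cancel : ∀ a → + 1 ℤ.* + 1 ℤ.* a ℤ.- (+ 2 ℤ.* 0ℤ ℤ.- a) ≡ + 2 ℤ.* a
    cancel = ℤ-solve-∀
    value-at-1 : evalAt1 N (euler N) ≡ ι (∑ (suc N) (eulerℤ N)) * ½^ N
    value-at-1 = sumℚ-upTo (suc N) (euler N) (eulerℤ N) (½^ N) (λ j _ → euler≡eulerℤ N j)

  scale-dyadic : ∀ z y e x → z ℤ.* y ≡ 2^ e ℤ.* x → ι z * ½^ e * ι y ≡ ι x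
  scale-dyadic z y e x zy≡2^ex = begin
    ι z * ½^ e * ι y           ≡⟨ swap (ι z) (½^ e) (ι y) ⟩
    ι z * ι y * ½^ e           ≡⟨ cong (_* ½^ e) (sym (ι-* z y)) ⟩
    ι (z ℤ.* y) * ½^ e         ≡⟨ cong (λ w → ι w * ½^ e) zy≡2^ex ⟩
    ι (2^ e ℤ.* x) * ½^ e      ≡⟨ cong (_* ½^ e) (ι-* (2^ e) x) ⟩
    ι (2^ e) * ι x * ½^ e      ≡⟨ swap (ι (2^ e)) (ι x) (½^ e) ⟩
    ι (2^ e) * ½^ e * ι x      ≡⟨ cong (_* ι x) (ι[2^e]*½^e≡1 e) ⟩
    1ℚ * ι x                   ≡⟨ ℚ.*-identityˡ (ι x) ⟩
    ι x                        ∎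
    where
    swap : ∀ a b c → a * b * c ≡ a * c * b
    swap = solve-∀ ℚ-ring

  [n+1]*eulerℤ-reflect : ∀ {n i} → i ≤ n →
    + suc n ℤ.* eulerℤ n (n ∸ i) ≡ 2^ n ℤ.* (+ binom (suc n) (suc i) ℤ.* genocchi i)
  [n+1]*eulerℤ-reflect {n} {i} i≤n = begin
    + suc n ℤ.* eulerℤ n (n ∸ i)
      ≡⟨ cong (+ suc n ℤ.*_) (eulerℤ-reflect i≤n) ⟩
    + suc n ℤ.* (+ binom n i ℤ.* 2^ (n ∸ i) ℤ.* A i)
      ≡⟨ assoc (+ suc n) (+ binom n i) (2^ (n ∸ i)) (A i) ⟩
    + suc n ℤ.* + binom n i ℤ.* 2^ (n ∸ i) ℤ.* A i
      ≡⟨ cong (λ c → c ℤ.* 2^ (n ∸ i) ℤ.* A i) absorption ⟩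
    + suc i ℤ.* + binom (suc n) (suc i) ℤ.* 2^ (n ∸ i) ℤ.* A i
      ≡⟨ collect-g (+ suc i) (+ binom (suc n) (suc i)) (2^ (n ∸ i)) (A i) ⟩
    + binom (suc n) (suc i) ℤ.* 2^ (n ∸ i) ℤ.* g i
      ≡⟨ cong (+ binom (suc n) (suc i) ℤ.* 2^ (n ∸ i) ℤ.*_) (g≡genocchi*2^ i) ⟩
    + binom (suc n) (suc i) ℤ.* 2^ (n ∸ i) ℤ.* (genocchi i ℤ.* 2^ i)
      ≡⟨ collect-2^ (+ binom (suc n) (suc i)) (2^ (n ∸ i)) (2^ i) (genocchi i) ⟩
    2^ (n ∸ i) ℤ.* 2^ i ℤ.* (+ binom (suc n) (suc i) ℤ.* genocchi i)
      ≡⟨ cong (ℤ._* (+ binom (suc n) (suc i) ℤ.* genocchi i))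
          (trans (sym (2^-+ (n ∸ i) i)) (cong 2^_ (ℕ.m∸n+n≡m i≤n))) ⟩
    2^ n ℤ.* (+ binom (suc n) (suc i) ℤ.* genocchi i) ∎
    where
    absorption : + suc n ℤ.* + binom n i ≡ + suc i ℤ.* + binom (suc n) (suc i)
    absorption = trans (sym (ℤ.pos-* (suc n) (binom n i)))
                       (trans (cong +_ (sym (binom-absorption n i))) (ℤ.pos-* (suc i) (binom (suc n) (suc i))))
    assoc : ∀ s c p a → s ℤ.* (c ℤ.* p ℤ.* a) ≡ s ℤ.* c ℤ.* p ℤ.* a
    assoc = ℤ-solve-∀
    collect-g : ∀ s c p a → s ℤ.* c ℤ.* p ℤ.* a ≡ c ℤ.* p ℤ.* (s ℤ.* a)
    collect-g = ℤ-solve-∀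
    collect-2^ : ∀ c p q y → c ℤ.* p ℤ.* (y ℤ.* q) ≡ p ℤ.* q ℤ.* (c ℤ.* y)
    collect-2^ = ℤ-solve-∀

  eulerShift-suc : ∀ n {j} → 0 < j → eulerShift n j ≡ ι (eulerℤ n j) * ½^ n
  eulerShift-suc n {suc j} _ = euler≡eulerℤ n (suc j)

  eulerShift-dyadic : ∀ n j → ∃[ z ] eulerShift (suc n) j ≡ ι z * ½^ (suc n)
  eulerShift-dyadic n zero    = + 2 ℤ.* A (suc n) , eulerShift-const n
  eulerShift-dyadic n (suc j) = eulerℤ (suc n) (suc j) , eulerShift-suc (suc n) (s≤s z≤n)

  eulerShift*[n+1] : ∀ {n i} → i < n →
    eulerShift n (n ∸ i) * ι (+ suc n) ≡ ι (+ binom (suc n) (suc i) ℤ.* genocchi i)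
  eulerShift*[n+1] {n} {i} i<n =
    trans (cong (_* ι (+ suc n)) (eulerShift-suc n (ℕ.m<n⇒0<n∸m i<n)))
          (scale-dyadic (eulerℤ n (n ∸ i)) (+ suc n) n X
            (trans (ℤ.*-comm (eulerℤ n (n ∸ i)) (+ suc n)) ([n+1]*eulerℤ-reflect (ℕ.<⇒≤ i<n))))
    where
    X = + binom (suc n) (suc i) ℤ.* genocchi i

  eulerShift₀*[n+1] : ∀ n → eulerShift (suc n) 0 * ι (+ suc (suc n)) ≡ ι (+ 2 ℤ.* genocchi (suc n))
  eulerShift₀*[n+1] n = trans (cong (_* ι (+ suc N)) (eulerShift-const n))
      (scale-dyadic (+ 2 ℤ.* A N) (+ suc N) N (+ 2 ℤ.* genocchi N) (begin
    + 2 ℤ.* A N ℤ.* + suc N              ≡⟨ regroup (A N) (+ suc N) ⟩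
    + 2 ℤ.* g N                          ≡⟨ cong (+ 2 ℤ.*_) (g≡genocchi*2^ N) ⟩
    + 2 ℤ.* (genocchi N ℤ.* 2^ N)        ≡⟨ rotate (genocchi N) (2^ N) ⟩
    2^ N ℤ.* (+ 2 ℤ.* genocchi N)        ∎))
    where
    N = suc n
    regroup : ∀ a s → + 2 ℤ.* a ℤ.* s ≡ + 2 ℤ.* (s ℤ.* a)
    regroup = ℤ-solve-∀
    rotate : ∀ y p → + 2 ℤ.* (y ℤ.* p) ≡ p ℤ.* (+ 2 ℤ.* y)
    rotate = ℤ-solve-∀

module Denominators where

  open import Data.Nat as ℕ using (ℕ; suc; _≤_; s≤s)
  import Data.Nat.Properties as ℕ
  open import Data.Nat.Divisibility as ℕ using (divides; ∣-antisym; ∣-trans)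
  open import Data.Nat.Coprimality using (coprime-divisor; recompute)
  import Data.Nat.Coprimality as Coprime
  open import Data.Nat.LCM using (lcm; m∣lcm[m,n]; n∣lcm[m,n]; lcm-least)
  import Data.Integer as ℤ
  open import Data.Integer using (ℤ; +_; ∣_∣)
  import Data.Integer.Properties as ℤ
  open import Data.Integer.Divisibility.Signed using (divides; ∣⇒∣ᵤ)
  open import Data.Rational using (mkℚ; _*_; toℚᵘ; ↥_; ↧_; ↧ₙ_)
  open import Data.Rational.Properties using (toℚᵘ-cong; toℚᵘ-homo-*)
  import Data.Rational.Unnormalised as ℚᵘ
  import Data.Rational.Unnormalised.Properties as ℚᵘ
  open import Data.List using ([]; _∷_; foldr; map; upTo)
  open import Data.List.Membership.Propositional using (_∈_)
  open import Data.List.Membership.Propositional.Properties using (∈-upTo⁺; ∈-upTo⁻)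
  open import Data.List.Relation.Unary.Any using (here; there)
  open import Data.Product using (∃-syntax; _,_; _×_)
  open import Relation.Binary.PropositionalEquality
  open import Defs using (Poly; polyDenom)
  open TwoAdic using (2^_; Odd; odd-cancelˡ)
  open EulerRational using (ι; toℚᵘ-ι)

  cross-multiply : ∀ q D w → q * ι (+ D) ≡ ι w → ↥ q ℤ.* + D ≡ w ℤ.* ↧ q
  cross-multiply q@(mkℚ a d _) D w q*D≡w
    with ℚᵘ.≃-trans (ℚᵘ.≃-sym (ℚᵘ.*-cong (ℚᵘ.≃-refl {toℚᵘ q}) (toℚᵘ-ι (+ D))))
           (ℚᵘ.≃-trans (ℚᵘ.≃-sym (toℚᵘ-homo-* q (ι (+ D)))) (ℚᵘ.≃-trans (toℚᵘ-cong q*D≡w) (toℚᵘ-ι w)))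
  ... | ℚᵘ.*≡* eq = trans (sym (ℤ.*-identityʳ (a ℤ.* + D)))
      (trans eq (cong (λ m → w ℤ.* + suc m) (ℕ.*-identityʳ d)))

  denominator-∣ : ∀ q D w → q * ι (+ D) ≡ ι w → ↧ₙ q ℕ.∣ D
  denominator-∣ q@(mkℚ a d coprime) D w q*D≡w =
    coprime-divisor (Coprime.sym (recompute coprime)) (divides ∣ w ∣ (begin
      ∣ a ∣ ℕ.* D          ≡⟨ sym (ℤ.abs-* a (+ D)) ⟩
      ∣ a ℤ.* + D ∣        ≡⟨ cong ∣_∣ (cross-multiply q D w q*D≡w) ⟩
      ∣ w ℤ.* + suc d ∣    ≡⟨ ℤ.abs-* w (+ suc d) ⟩
      ∣ w ∣ ℕ.* suc d      ∎))
    where open ≡-Reasoning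

  denominator-≡2^ : ∀ q t w → q * ι (2^ t) ≡ ι w → Odd w → ↧ₙ q ≡ 2 ℕ.^ t
  denominator-≡2^ q t w q*2^t≡w odd-w = ∣-antisym (denominator-∣ q (2 ℕ.^ t) w q*2^t≡w)
    (∣⇒∣ᵤ (odd-cancelˡ t odd-w (divides (↥ q) (sym (cross-multiply q (2 ℕ.^ t) w q*2^t≡w)))))

  polyDenom-∣ : ∀ d (p : Poly) D → (∀ j → j ≤ d → ↧ₙ (p j) ℕ.∣ D) → polyDenom d p ℕ.∣ D
  polyDenom-∣ d p D ↧∣D = lcm-fold-least (upTo (suc d)) (λ j j∈ → ↧∣D j (ℕ.≤-pred (∈-upTo⁻ j∈)))
    where
    lcm-fold-least : ∀ js → (∀ j → j ∈ js → ↧ₙ (p j) ℕ.∣ D) → foldr lcm 1 (map (λ j → ↧ₙ (p j)) js) ℕ.∣ D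
    lcm-fold-least []       _   = ℕ.1∣ D
    lcm-fold-least (j ∷ js) ↧∣D = lcm-least (↧∣D j (here refl)) (lcm-fold-least js (λ i i∈ → ↧∣D i (there i∈)))

  ∣-polyDenom : ∀ d (p : Poly) {j} → j ≤ d → ↧ₙ (p j) ℕ.∣ polyDenom d p
  ∣-polyDenom d p j≤d = ∣-lcm-fold (upTo (suc d)) (∈-upTo⁺ (s≤s j≤d))
    where
    ∣-lcm-fold : ∀ {j} js → j ∈ js → ↧ₙ (p j) ℕ.∣ foldr lcm 1 (map (λ j → ↧ₙ (p j)) js)
    ∣-lcm-fold (j ∷ js) (here refl) = m∣lcm[m,n] (↧ₙ (p j)) (foldr lcm 1 (map (λ j → ↧ₙ (p j)) js))
    ∣-lcm-fold (i ∷ js) (there j∈)  = ∣-trans (∣-lcm-fold js j∈)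
        (n∣lcm[m,n] (↧ₙ (p i)) (foldr lcm 1 (map (λ j → ↧ₙ (p j)) js)))

  polyDenom-≡ : ∀ d (p : Poly) D → (∀ j → j ≤ d → ↧ₙ (p j) ℕ.∣ D) →
                ∃[ j ] (j ≤ d × ↧ₙ (p j) ≡ D) → polyDenom d p ≡ D
  polyDenom-≡ d p D ↧∣D (j , j≤d , ↧≡D) =
    ∣-antisym (polyDenom-∣ d p D ↧∣D) (subst (ℕ._∣ polyDenom d p) ↧≡D (∣-polyDenom d p j≤d))

module DenominatorOfShiftedEuler where

  open import Defs
  open import Data.Nat as ℕ using (ℕ; zero; suc; _^_; _∸_; _≤_; _<_; z≤n; s≤s)
  import Data.Nat.Properties as ℕ
  import Data.Nat.DivMod as ℕ
  import Data.Nat.Divisibility as ℕ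
  import Data.Integer as ℤ
  open import Data.Integer using (ℤ; +_)
  import Data.Integer.Properties as ℤ
  open import Data.Integer.Divisibility.Signed using (divides; quotient) renaming (_∣_ to _∣ᶻ_)
  import Data.Rational as ℚ
  open ℚ using (ℚ; ½; _*_; ↧ₙ_)
  import Data.Rational.Properties as ℚ
  open import Data.Product using (∃-syntax; _,_; _×_; proj₁; proj₂)
  open import Relation.Binary.PropositionalEquality
  open import Tactic.RingSolver using (solve-∀)
  open import Data.Integer.Tactic.RingSolver renaming (solve-∀ to ℤ-solve-∀)
  open ≡-Reasoning
  open Binomial
  open BinomialParity
  open TwoAdic
  open Genocchi using (genocchi; genocchi-mersenne-odd)
  open EulerRational using (ι; ι-*; ι-injective; ½^; ι[2^e]*½^e≡1; ℚ-ring)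
  open ShiftedEuler
  open Denominators

  -- The odd part N of the scale N·2ᵏ cancels against the power-of-two denominator of q.
  dyadic-odd-cancel : ∀ {q} z e k N X → q ≡ ι z * ½^ e → Odd (+ N) → q * ι (+ (N ℕ.* 2 ^ k)) ≡ ι X →
                      ∃[ w ] (q * ι (2^ k) ≡ ι w × + N ℤ.* w ≡ X)
  dyadic-odd-cancel {q} z e k N X refl odd-N q*M≡X =
    w , scale-dyadic z (2^ k) e w (trans z*2^k≡w*2^e (ℤ.*-comm w (2^ e))) , N*w≡X
    where
    M = + (N ℕ.* 2 ^ k)
    z*M≡2^e*X : z ℤ.* M ≡ 2^ e ℤ.* X
    z*M≡2^e*X = ι-injective (begin
      ι (z ℤ.* M)                          ≡⟨ ι-* z M ⟩
      ι z * ι M                            ≡⟨ sym (ℚ.*-identityˡ (ι z * ι M)) ⟩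
      ℚ.1ℚ * (ι z * ι M)                   ≡⟨ cong (_* (ι z * ι M)) (sym (ι[2^e]*½^e≡1 e)) ⟩
      ι (2^ e) * ½^ e * (ι z * ι M)        ≡⟨ regroup (ι (2^ e)) (½^ e) (ι z) (ι M) ⟩
      ι (2^ e) * (ι z * ½^ e * ι M)        ≡⟨ cong (ι (2^ e) *_) q*M≡X ⟩
      ι (2^ e) * ι X                       ≡⟨ sym (ι-* (2^ e) X) ⟩
      ι (2^ e ℤ.* X)                       ∎)
      where
      regroup : ∀ p h a m → p * h * (a * m) ≡ p * (a * h * m)
      regroup = solve-∀ ℚ-ring
    N*z2^k≡X*2^e : + N ℤ.* (z ℤ.* 2^ k) ≡ X ℤ.* 2^ e
    N*z2^k≡X*2^e = begin
      + N ℤ.* (z ℤ.* 2^ k)     ≡⟨ rotate (+ N) z (2^ k) ⟩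
      z ℤ.* (+ N ℤ.* 2^ k)     ≡⟨ cong (z ℤ.*_) (sym (ℤ.pos-* N (2 ^ k))) ⟩
      z ℤ.* M                  ≡⟨ z*M≡2^e*X ⟩
      2^ e ℤ.* X               ≡⟨ ℤ.*-comm (2^ e) X ⟩
      X ℤ.* 2^ e               ∎
      where
      rotate : ∀ n z p → n ℤ.* (z ℤ.* p) ≡ z ℤ.* (n ℤ.* p)
      rotate = ℤ-solve-∀
    2^e∣z*2^k : 2^ e ∣ᶻ z ℤ.* 2^ k
    2^e∣z*2^k = odd-cancelˡ e odd-N (divides X N*z2^k≡X*2^e)
    w : ℤ
    w = quotient 2^e∣z*2^k
    z*2^k≡w*2^e : z ℤ.* 2^ k ≡ w ℤ.* 2^ e
    z*2^k≡w*2^e = _∣ᶻ_.equality 2^e∣z*2^k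
    N*w≡X : + N ℤ.* w ≡ X
    N*w≡X = ℤ.*-cancelʳ-≡ (+ N ℤ.* w) X (2^ e) {{ℕ.m^n≢0 2 e}} (begin
      + N ℤ.* w ℤ.* 2^ e       ≡⟨ ℤ.*-assoc (+ N) w (2^ e) ⟩
      + N ℤ.* (w ℤ.* 2^ e)     ≡⟨ cong (+ N ℤ.*_) (sym z*2^k≡w*2^e) ⟩
      + N ℤ.* (z ℤ.* 2^ k)     ≡⟨ N*z2^k≡X*2^e ⟩
      X ℤ.* 2^ e               ∎)

  halve : ∀ q t w → q * ι (2^ suc t) ≡ ι (+ 2 ℤ.* w) → q * ι (2^ t) ≡ ι w
  halve q t w q*2^t+1≡2w = begin
    q * ι (2^ t)
      ≡⟨ cancel-2 q (ι (2^ t)) ⟩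
    ½ * (q * (ι (+ 2) * ι (2^ t)))
      ≡⟨ cong (λ x → ½ * (q * x)) (sym (trans (cong ι (2^-suc t)) (ι-* (+ 2) (2^ t)))) ⟩
    ½ * (q * ι (2^ suc t))
      ≡⟨ cong (½ *_) q*2^t+1≡2w ⟩
    ½ * ι (+ 2 ℤ.* w)
      ≡⟨ cong (½ *_) (ι-* (+ 2) w) ⟩
    ½ * (ι (+ 2) * ι w)
      ≡⟨ cancel-2′ (ι w) ⟩
    ι w ∎
    where
    cancel-2 : ∀ a b → a * b ≡ ½ * (a * (ι (+ 2) * b))
    cancel-2 = solve-∀ ℚ-ring
    cancel-2′ : ∀ a → ½ * (ι (+ 2) * a) ≡ a
    cancel-2′ = solve-∀ ℚ-ring

  polyDenom-mersenne : ∀ k → polyDenom (mersenne (suc k)) (eulerShift (mersenne (suc k))) ≡ 2 ^ k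
  polyDenom-mersenne k = polyDenom-≡ n (eulerShift n) (2 ^ k) bound (0 , z≤n , exact₀)
    where
    n′ = double (mersenne k)
    n  = suc n′
    n+1≡2^k+1 : suc n ≡ 2 ^ suc k
    n+1≡2^k+1 = suc-mersenne (suc k)
    c₀*2^k≡G : eulerShift n 0 * ι (2^ k) ≡ ι (genocchi n)
    c₀*2^k≡G = halve (eulerShift n 0) k (genocchi n)
        (subst (λ m → eulerShift n 0 * ι (+ m) ≡ ι (+ 2 ℤ.* genocchi n)) n+1≡2^k+1 (eulerShift₀*[n+1] n′))
    exact₀ : ↧ₙ (eulerShift n 0) ≡ 2 ^ k
    exact₀ = denominator-≡2^ (eulerShift n 0) k (genocchi n) c₀*2^k≡G (genocchi-mersenne-odd (suc k))
    bound : ∀ j → j ≤ n → ↧ₙ (eulerShift n j) ℕ.∣ 2 ^ k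
    bound zero    _   = denominator-∣ (eulerShift n 0) (2 ^ k) (genocchi n) c₀*2^k≡G
    bound (suc j) j<n = denominator-∣ (eulerShift n (suc j)) (2 ^ k) (+ (C ℕ./ 2) ℤ.* genocchi i)
      (halve (eulerShift n (suc j)) k (+ (C ℕ./ 2) ℤ.* genocchi i) (begin
        eulerShift n (suc j) * ι (2^ suc k)
          ≡⟨ cong₂ (λ a b → eulerShift n a * ι (+ b)) (sym n∸i≡j+1) (sym n+1≡2^k+1) ⟩
        eulerShift n (n ∸ i) * ι (+ suc n)
          ≡⟨ eulerShift*[n+1] i<n ⟩
        ι (+ C ℤ.* genocchi i)
          ≡⟨ cong (λ c → ι (+ c ℤ.* genocchi i)) (≡₂0⇒≡*2 C-even) ⟩
        ι (+ (C ℕ./ 2 ℕ.* 2) ℤ.* genocchi i)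
          ≡⟨ cong ι (trans (cong (ℤ._* genocchi i) (ℤ.pos-* (C ℕ./ 2) 2)) (regroup (+ (C ℕ./ 2)) (genocchi i))) ⟩
        ι (+ 2 ℤ.* (+ (C ℕ./ 2) ℤ.* genocchi i)) ∎))
      where
      i = n ∸ suc j
      i<n : i < n
      i<n = ℕ.∸-monoʳ-< (s≤s z≤n) j<n
      n∸i≡j+1 : n ∸ i ≡ suc j
      n∸i≡j+1 = ℕ.m∸[m∸n]≡n j<n
      C = binom (suc n) (suc i)
      C-even : C ≡₂ 0
      C-even = subst (λ m → binom m (suc i) ≡₂ 0) (sym n+1≡2^k+1)
                 (binom[2^r,j]≡₂0 (suc k) (suc i) (s≤s z≤n) (subst (suc i <_) n+1≡2^k+1 (s≤s i<n)))
      regroup : ∀ c y → c ℤ.* + 2 ℤ.* y ≡ + 2 ℤ.* (c ℤ.* y)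
      regroup = ℤ-solve-∀

  polyDenom-non-mersenne : ∀ n k N → 1 ≤ n → suc n ≡ N ℕ.* 2 ^ k → N ≡₂ 1 → mersenne k ≢ n →
                           polyDenom n (eulerShift n) ≡ 2 ^ k
  polyDenom-non-mersenne n@(suc n′) k N _ n+1≡N*2^k N≡₂1 mersenne≢n =
    polyDenom-≡ n (eulerShift n) (2 ^ k) bound (n ∸ i₀ , ℕ.m∸n≤m n i₀ , exact)
    where
    rescale : ∀ j X → eulerShift n j * ι (+ suc n) ≡ ι X →
              ∃[ w ] (eulerShift n j * ι (2^ k) ≡ ι w × + N ℤ.* w ≡ X)
    rescale j X c*[n+1]≡X = dyadic-odd-cancel (proj₁ (eulerShift-dyadic n′ j)) n k N X
        (proj₂ (eulerShift-dyadic n′ j))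
      (≡₂1⇒odd N≡₂1) (subst (λ m → eulerShift n j * ι (+ m) ≡ ι X) n+1≡N*2^k c*[n+1]≡X)
    reflected : ∀ {i} → i < n → ∃[ w ]
        (eulerShift n (n ∸ i) * ι (2^ k) ≡ ι w × + N ℤ.* w ≡ + binom (suc n) (suc i) ℤ.* genocchi i)
    reflected {i} i<n = rescale (n ∸ i) (+ binom (suc n) (suc i) ℤ.* genocchi i) (eulerShift*[n+1] i<n)
    bound-from : ∀ j X → ∃[ w ] (eulerShift n j * ι (2^ k) ≡ ι w × + N ℤ.* w ≡ X) → ↧ₙ (eulerShift n j) ℕ.∣ 2 ^ k
    bound-from j X (w , c*2^k≡w , _) = denominator-∣ (eulerShift n j) (2 ^ k) w c*2^k≡w
    bound : ∀ j → j ≤ n → ↧ₙ (eulerShift n j) ℕ.∣ 2 ^ k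
    bound zero    _   = bound-from 0 (+ 2 ℤ.* genocchi n) (rescale 0 (+ 2 ℤ.* genocchi n) (eulerShift₀*[n+1] n′))
    bound (suc j) j<n = subst (λ a → ↧ₙ (eulerShift n a) ℕ.∣ 2 ^ k) (ℕ.m∸[m∸n]≡n j<n)
                              (bound-from (n ∸ i) (+ binom (suc n) (suc i) ℤ.* genocchi i) (reflected i<n))
      where
      i = n ∸ suc j
      i<n : i < n
      i<n = ℕ.∸-monoʳ-< (s≤s z≤n) j<n
    i₀ = mersenne k
    i₀<n : i₀ < n
    i₀<n = ℕ.≤∧≢⇒< (ℕ.≤-pred (subst (ℕ._≤ suc n) (sym (suc-mersenne k)) 2^k≤n+1)) mersenne≢n
      where
      2^k≤n+1 : 2 ^ k ≤ suc n
      2^k≤n+1 = ℕ.∣⇒≤ (ℕ.divides N n+1≡N*2^k)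
    odd-X : Odd (+ binom (suc n) (suc i₀) ℤ.* genocchi i₀)
    odd-X = odd-* {+ binom (suc n) (suc i₀)} {genocchi i₀} (≡₂1⇒odd C≡₂1) (genocchi-mersenne-odd k)
      where
      C≡₂1 : binom (suc n) (suc i₀) ≡₂ 1
      C≡₂1 = ≡₂-trans (≡₂-reflexive (cong₂ binom (trans n+1≡N*2^k (ℕ.*-comm N (2 ^ k))) (suc-mersenne k)))
                      (≡₂-trans (binom[2^k*n,2^k]≡₂n k N) N≡₂1)
    exact = exact-from (reflected i₀<n)
      where
      exact-from : ∃[ w ] (eulerShift n (n ∸ i₀) * ι (2^ k) ≡ ι w × + N ℤ.* w ≡ + binom (suc n) (suc i₀) ℤ.* genocchi i₀) →
                   ↧ₙ (eulerShift n (n ∸ i₀)) ≡ 2 ^ k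
      exact-from (w , c*2^k≡w , N*w≡X) =
        denominator-≡2^ (eulerShift n (n ∸ i₀)) k w c*2^k≡w (odd-*⁻ʳ (+ N) (subst Odd (sym N*w≡X) odd-X))

open import Defs
open import Data.Nat using (ℕ; suc; _^_; _∸_; _≤_)
open import Data.Nat.Divisibility using (_∣_)
open import Relation.Binary.PropositionalEquality using (_≡_)
open import Relation.Nullary using (¬_)
open import Data.Product using (_×_)

open import Data.Nat using (zero; z≤n; s≤s)
open import Data.Nat.Properties using (0≢1+n)
open import Data.Nat.Divisibility using (divides)
open import Data.Product using (_,_)
open import Relation.Binary.PropositionalEquality using (_≢_; sym; trans; cong; subst₂)
open BinomialParity using (mersenne; mersenne≡2^∸1; suc-mersenne)
open TwoAdic using (2-adic-valuation-unique; odd-cofactor)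
open DenominatorOfShiftedEuler using (polyDenom-mersenne; polyDenom-non-mersenne)

mainTheorem1 : (n : ℕ) → 1 ≤ n → (k : ℕ) → 2 ^ k ∣ suc n → ¬ (2 ^ suc k ∣ suc n)
    → (IsMersenne n → polyDenom n (eulerShift n) ≡ 2 ^ (k ∸ 1))
    × (¬ IsMersenne n → polyDenom n (eulerShift n) ≡ 2 ^ k)
mainTheorem1 (suc n′) 1≤n k 2^k∣n+1@(divides N n+1≡N*2^k) ¬2^k+1∣n+1 = mersenne-case , non-mersenne-case
  where
  mersenne-case : IsMersenne (suc n′) → polyDenom (suc n′) (eulerShift (suc n′)) ≡ 2 ^ (k ∸ 1)
  mersenne-case (suc m , _ , n≡2^m∸1) =
    subst₂ (λ n e → polyDenom n (eulerShift n) ≡ 2 ^ e) (sym n≡mersenne) (cong (_∸ 1) (sym k≡m+1))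
        (polyDenom-mersenne m)
    where
    n≡mersenne : suc n′ ≡ mersenne (suc m)
    n≡mersenne = trans n≡2^m∸1 (sym (mersenne≡2^∸1 (suc m)))
    k≡m+1 : k ≡ suc m
    k≡m+1 = 2-adic-valuation-unique 2^k∣n+1 ¬2^k+1∣n+1 (trans (cong suc n≡mersenne) (suc-mersenne (suc m)))
  non-mersenne-case : ¬ IsMersenne (suc n′) → polyDenom (suc n′) (eulerShift (suc n′)) ≡ 2 ^ k
  non-mersenne-case ¬mersenne =
    polyDenom-non-mersenne (suc n′) k N 1≤n n+1≡N*2^k (odd-cofactor k N n+1≡N*2^k ¬2^k+1∣n+1) (mersenne≢n k)
    where
    mersenne≢n : ∀ k′ → mersenne k′ ≢ suc n′
    mersenne≢n zero     = 0≢1+n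
    mersenne≢n (suc k′) eq = ¬mersenne (suc k′ , s≤s z≤n , trans (sym eq) (mersenne≡2^∸1 (suc k′)))
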